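{- Let $N$ be a rooted cactus with $n$ leaves and $k$ reticulations. Then $Q(N)$ is a polynomial of degree $n+2k$.
   Context: A rooted cactus is a finite directed acyclic graph with exactly one vertex of indegree 0 (the root), every vertex reachable from the root by a directed path, whose underlying undirected graph is a cactus (connected, any two cycles edge-disjoint). A leaf has outdegree 0, a reticulation indegree 2. A reticulation cycle for a reticulation $v$ is a pair of internally vertex-disjoint directed paths ending at $v$ with a common starting vertex, the top vertex. Labelled expansion $(T_N,\mu_N)$: (A) for every vertex $v$ that is the top vertex of $c\ge1$ reticulation cycles, with children $w_1,w_1',\dots,w_c,w_c'$ of $v$ such that each pair $(w_i,w_i')$ lies on the same reticulation cycle, add for each $i$ a new vertex $v_i$ with arc $(v,v_i)$, replace $(v,w_i),(v,w_i')$ by $(v_i,w_i),(v_i,w_i')$, label $v_i$ by $s$; call the result $N'$. (B') While there is a reticulation, take a lowest reticulation cycle, with top vertex $v_t$ and reticulation $v$ with parents $u,u'$; remove $(u,v),(u',v)$, add new vertices $p,p'$ with arcs $(u,p),(u',p')$, add arc $(v_t,v)$; label $p,p'$ by $q$, and $v$ by $z$ if internal, $r$ if a leaf. The result is a rooted tree $T_N$. (C) Label remaining unlabelled leaves $x$ and other unlabelled vertices $y$, giving $\mu_N$. For a rooted tree $T$ with labelling $\lambda$ by indeterminates, $P(T,\lambda)$ is defined recursively: if $T$ is a single vertex $v$, $P=\lambda(v)$; if $T$ consists of root $\rho$ with arcs to the roots of subtrees $T_1,\dots,T_k$, then $P(T,\lambda)=\lambda(\rho)+\prod_{i=1}^kP(T_i,\lambda|_{V(T_i)})$.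 Set $Q(N)=P(T_N,\mu_N)\in\mathbb Z[x,y,z,q,r,s]$. -}

module Defs where

open import Data.Nat using (ℕ; zero; suc; _+_; _*_; _≤_; _≡ᵇ_)
open import Data.Nat.Properties using ()
open import Data.Integer using (ℤ; +_) renaming (_+_ to _+ℤ_; _*_ to _*ℤ_)
open import Data.Bool using (Bool; true; false; if_then_else_; _∨_; _∧_)
open import Data.Maybe using (Maybe; just; nothing)
open import Data.Fin using (Fin; zero; suc)
import Data.Fin as Fin
open import Data.List using (List; []; _∷_; _++_; map; foldr; concatMap; filter; allFin; length; zip; [_])
open import Data.List.Membership.Propositional using (_∈_)
open import Data.List.Relation.Unary.Unique.Propositional using (Unique)
open import Data.Vec using (Vec; []; _∷_; replicate; zipWith)
import Data.Vec as Vec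
import Data.Vec.Properties as VecP
open import Data.Product using (Σ; ∃; _×_; _,_)
open import Data.Sum using (_⊎_)
open import Data.Empty using (⊥)
open import Data.Unit using (⊤)
open import Relation.Nullary using (¬_; Dec; yes; no)
open import Relation.Nullary.Decidable using (⌊_⌋)
open import Relation.Binary.PropositionalEquality using (_≡_; _≢_)
open import Relation.Binary.Construct.Closure.ReflexiveTransitive using (Star)

-- The six indeterminates (also used as vertex labels).
data Label : Set where
  x y z q r s : Label

labelIndex : Label → Fin 6
labelIndex x = zero
labelIndex y = suc zero
labelIndex z = suc (suc zero)
labelIndex q = suc (suc (suc zero))
labelIndex r = suc (suc (suc (suc zero)))
labelIndex s = suc (suc (suc (suc (suc zero))))

-- A monomial: exponent vector for (x,y,z,q,r,s).
Monomial : Set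
Monomial = Vec ℕ 6

totalDegree : Monomial → ℕ
totalDegree = Vec.foldr _ _+_ 0

-- A polynomial, given as a finite formal sum of terms c·m.
-- Its actual coefficients are obtained with 'coeff' (terms with the same
-- monomial are collected), so this represents Z[x,y,z,q,r,s] faithfully.
Poly : Set
Poly = List (ℤ × Monomial)

coeff : Poly → Monomial → ℤ
coeff [] m = + 0
coeff ((c , m') ∷ p) m with VecP.≡-dec Data.Nat._≟_ m' m
... | yes _ = c +ℤ coeff p m
... | no _  = coeff p m

var : Label → Poly
var l = [ (+ 1 , Vec.updateAt (replicate 6 0) (labelIndex l) (λ _ → 1)) ]

one : Poly
one = [ (+ 1 , replicate 6 0) ]

_⊕_ : Poly → Poly → Poly
p ⊕ p' = p ++ p'

_⊗_ : Poly → Poly → Poly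
p ⊗ p' = concatMap (λ { (c , m) → map (λ { (c' , m') → (c *ℤ c' , zipWith _+_ m m') }) p' }) p

prodP : List Poly → Poly
prodP = foldr _⊗_ one

HasDegree : Poly → ℕ → Set
HasDegree p d =
  (∃ λ m → totalDegree m ≡ d × coeff p m ≢ + 0)
  × (∀ m → coeff p m ≢ + 0 → totalDegree m ≤ d)

Arcs : ℕ → Set
Arcs m = Fin m → Fin m → Bool

module _ {m : ℕ} (E : Arcs m) where

  Arc : Fin m → Fin m → Set
  Arc u v = E u v ≡ true

  countTrue : List Bool → ℕ
  countTrue [] = 0
  countTrue (true ∷ bs) = suc (countTrue bs)
  countTrue (false ∷ bs) = countTrue bs

  indeg : Fin m → ℕ
  indeg v = countTrue (map (λ u → E u v) (allFin m))

  outdeg : Fin m → ℕ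
  outdeg v = countTrue (map (λ w → E v w) (allFin m))

  isLeafB : Fin m → Bool
  isLeafB v = outdeg v ≡ᵇ 0

  IsReticulation : Fin m → Set
  IsReticulation v = indeg v ≡ 2

  numLeaves : ℕ
  numLeaves = countTrue (map isLeafB (allFin m))

  numReticulations : ℕ
  numReticulations = countTrue (map (λ v → indeg v ≡ᵇ 2) (allFin m))

  Reach : Fin m → Fin m → Set
  Reach = Star Arc

  Acyclic : Set
  Acyclic = ∀ u v → Arc u v → Reach v u → ⊥

  Chain : List (Fin m) → Set
  Chain [] = ⊤
  Chain (_ ∷ []) = ⊤
  Chain (u ∷ v ∷ vs) = Arc u v × Chain (v ∷ vs)

  Disjoint : List (Fin m) → List (Fin m) → Set
  Disjoint as bs = ∀ w → w ∈ as → w ∈ bs → ⊥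

  -- second vertex of the path t, is..., v
  secondOf : List (Fin m) → Fin m → Fin m
  secondOf [] v = v
  secondOf (w ∷ _) v = w

  -- A reticulation cycle for reticulation v with top vertex t, given by the
  -- internal vertex lists of the two directed paths t → … → v, which are
  -- internally vertex-disjoint and distinct (distinct second vertices w, w').
  RetCycle : (t v w w' : Fin m) → Set
  RetCycle t v w w' =
    IsReticulation v ×
    Σ (List (Fin m)) λ is₁ → Σ (List (Fin m)) λ is₂ →
      Chain (t ∷ is₁ ++ [ v ]) × Chain (t ∷ is₂ ++ [ v ]) ×
      Disjoint is₁ is₂ ×
      secondOf is₁ v ≡ w × secondOf is₂ v ≡ w' × w ≢ w'

  Adj : Fin m → Fin m → Set
  Adj u v = Arc u v ⊎ Arc v u

  Connected : Set
  Connected = ∀ u v → Star Adj u v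

  AdjChain : List (Fin m) → Set
  AdjChain [] = ⊤
  AdjChain (_ ∷ []) = ⊤
  AdjChain (u ∷ v ∷ vs) = Adj u v × AdjChain (v ∷ vs)

  cycleEdges : List (Fin m) → List (Fin m × Fin m)
  cycleEdges [] = []
  cycleEdges (c ∷ cs) = zip (c ∷ cs) (cs ++ [ c ])

  IsCycle : List (Fin m) → Set
  IsCycle [] = ⊥
  IsCycle (c ∷ cs) = 3 ≤ length (c ∷ cs) × Unique (c ∷ cs) × AdjChain (c ∷ cs ++ [ c ])

  EdgeOf : Fin m → Fin m → List (Fin m) → Set
  EdgeOf a b C = ∃ λ e → e ∈ cycleEdges C × (e ≡ (a , b) ⊎ e ≡ (b , a))

  -- any two (distinct) cycles are edge-disjoint: two cycles sharing an edge
  -- have the same edge set, i.e. are the same cycle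
  CycleEdgeDisjoint : Set
  CycleEdgeDisjoint = ∀ C C' → IsCycle C → IsCycle C' →
    (∃ λ a → ∃ λ b → EdgeOf a b C × EdgeOf a b C') →
    ∀ a b → (EdgeOf a b C → EdgeOf a b C') × (EdgeOf a b C' → EdgeOf a b C)

  IsRootedCactus : Fin m → Set
  IsRootedCactus ρ =
    Acyclic ×
    indeg ρ ≡ 0 × (∀ v → indeg v ≡ 0 → v ≡ ρ) ×
    (∀ v → Reach ρ v) ×
    Connected × CycleEdgeDisjoint

record LGraph : Set where
  constructor mkLG
  field
    size  : ℕ
    arcs  : Arcs size
    label : Fin size → Maybe Label
    root  : Fin size
open LGraph public

infix 4 _==_
_==_ : {m : ℕ} → Fin m → Fin m → Bool
a == b = ⌊ a Fin.≟ b ⌋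

-- Step (A) for one reticulation cycle with top t whose children on the
-- cycle are w, w': new vertex (index zero, old vertices shifted by suc)
-- with arc (t,new), arcs (t,w),(t,w') replaced by (new,w),(new,w'); label s.
addA : (G : LGraph) → (t w w' : Fin (size G)) → LGraph
addA (mkLG m E lab ρ) t w w' = mkLG (suc m) E' lab' (suc ρ)
  where
  E' : Arcs (suc m)
  E' zero zero = false
  E' zero (suc b) = (b == w) ∨ (b == w')
  E' (suc a) zero = a == t
  E' (suc a) (suc b) = if (a == t) ∧ ((b == w) ∨ (b == w')) then false else E a b
  lab' : Fin (suc m) → Maybe Label
  lab' zero = just s
  lab' (suc a) = lab a

-- Step (B') for a reticulation v with parents u, u' and reticulation cycle
-- top t: new vertices p (index 0) and p' (index 1); old vertices shifted by
-- two; remove (u,v),(u',v); add (u,p),(u',p'),(t,v); label p,p' by q and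
-- v by z (internal) or r (leaf).
addB : (G : LGraph) → (t v u u' : Fin (size G)) → LGraph
addB (mkLG m E lab ρ) t v u u' = mkLG (suc (suc m)) E' lab' (suc (suc ρ))
  where
  E' : Arcs (suc (suc m))
  E' (suc (suc a)) (suc (suc b)) =
    if (a == t) ∧ (b == v) then true
    else if (b == v) ∧ ((a == u) ∨ (a == u')) then false
    else E a b
  E' (suc (suc a)) zero = a == u
  E' (suc (suc a)) (suc zero) = a == u'
  E' _ _ = false
  lab' : Fin (suc (suc m)) → Maybe Label
  lab' zero = just q
  lab' (suc zero) = just q
  lab' (suc (suc a)) = if a == v then just (if isLeafB E v then r else z) else lab a

data StepA : LGraph → LGraph → Set where
  stepA : ∀ G (t v w w' : Fin (size G)) →
    RetCycle (arcs G) t v w w' → label G t ≢ just s →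
    StepA G (addA G t w w')

PhaseADone : LGraph → Set
PhaseADone G = ∀ t v w w' → RetCycle (arcs G) t v w w' → label G t ≡ just s

Lowest : (G : LGraph) → Fin (size G) → Set
Lowest G v = ∀ w → w ≢ v → Reach (arcs G) v w → ¬ IsReticulation (arcs G) w

data StepB : LGraph → LGraph → Set where
  stepB : ∀ G (t v w w' u u' : Fin (size G)) →
    RetCycle (arcs G) t v w w' → Lowest G v →
    Arc (arcs G) u v → Arc (arcs G) u' v → u ≢ u' →
    StepB G (addB G t v u u')

NoReticulation : LGraph → Set
NoReticulation G = ∀ v → ¬ IsReticulation (arcs G) v

-- G is (T_N, partial labelling before step (C)) obtained from N = (Fin m, E, ρ)
-- by steps (A) and (B')
Expansion : (m : ℕ) → Arcs m → Fin m → LGraph → Set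
Expansion m E ρ G = ∃ λ G₁ →
  Star StepA (mkLG m E (λ _ → nothing) ρ) G₁ × PhaseADone G₁ ×
  Star StepB G₁ G × NoReticulation G

finalLabel : (G : LGraph) → Fin (size G) → Label
finalLabel G v with label G v
... | just l = l
... | nothing = if isLeafB (arcs G) v then x else y

-- P(T, λ) on the tree (T, λ), computed from vertex v; the fuel bounds the
-- recursion depth (depth of a tree on 'size' vertices is < size).
children : {m : ℕ} → Arcs m → Fin m → List (Fin m)
children {m} E v = filter (λ w → E v w Data.Bool.≟ true) (allFin m)

Pat : (G : LGraph) → ℕ → Fin (size G) → Poly
Pat G zero v = var (finalLabel G v)
Pat G (suc f) v with children (arcs G) v
... | [] = var (finalLabel G v)
... | cs@(_ ∷ _) = var (finalLabel G v) ⊕ prodP (map (Pat G f) cs)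

Qof : LGraph → Poly
Qof G = Pat G (size G) (root G)

-- Steps (A) and (B') keep the graph acyclic, rooted and of in-degree at most 2; for a cactus the last
-- holds from the start, since a vertex with three parents would lie on two cycles sharing an arc but not
-- their other arcs. Step (A) preserves the numbers of leaves and reticulations, while step (B') removes
-- one reticulation and adds two leaves (the q-vertices), so the final tree T_N has n + 2k leaves. All
-- coefficients of P(T, λ) are positive, so nothing cancels and its degree is the number of leaves of T:
-- a leaf contributes a variable, an inner vertex the product over its children.
--
-- The expansion exists: every reticulation lies on a reticulation cycle, whose top vertex is the last
-- vertex of a root path to one parent that lies on a root path to the other; step (A) terminates since
-- the total out-degree of vertices not labelled s drops, step (B') since the reticulations do, and a
-- lowest reticulation is found by descending, which shrinks the set of descendants.

module Submission where

open import Defs hiding (x; y; z; q; r; s)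
open import Data.Bool using (Bool; true; false; if_then_else_; _∨_; _∧_)
open import Data.Bool.ListAction using (any)
open import Data.Bool.Properties using (∨-zeroʳ; ∧-zeroʳ; ∧-identityʳ)
open import Data.Empty using (⊥; ⊥-elim)
open import Data.Fin as Fin using (Fin; zero; suc)
import Data.Fin.Properties as FinP
import Data.Integer as ℤ
open import Data.List
  using (List; []; _∷_; _++_; [_]; _ʳ++_; reverse; map; cartesianProductWith; allFin; tabulate; length; lookup; zip)
open import Data.List.Properties using (length-++; map-tabulate; map-cong-local; ++-assoc; ++-ʳ++; ʳ++-defn)
open import Data.List.Membership.Propositional using (_∈_; _∉_; find)
import Data.List.Membership.DecPropositional as DecMembership
open import Data.List.Membership.Propositional.Properties
  using (∈-lookup; ∈-allFin; ∈-cartesianProductWith⁺; ∈-filter⁺; ∈-filter⁻)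
open import Data.List.Relation.Unary.All as All using (All; []; _∷_; all?)
import Data.List.Relation.Unary.All.Properties as AllP
open import Data.List.Relation.Unary.AllPairs using ([]; _∷_)
open import Data.List.Relation.Unary.Any as Any using (Any; here; there; any?; satisfied)
open import Data.List.Relation.Unary.Any.Properties as AnyP using (reverseAcc⁺; reverseAcc⁻)
open import Data.List.Relation.Unary.Unique.Propositional using (Unique)
import Data.List.Relation.Unary.Unique.Propositional.Properties as UniqueP
open import Data.Maybe using (Maybe; just; nothing)
open import Data.Nat using (ℕ; zero; suc; _+_; _*_; _≤_; _<_; _≤?_; z≤n; s≤s; s≤s⁻¹; _≡ᵇ_)
open import Data.Nat.ListAction using (sum)
open import Data.Nat.Properties
open import Data.Product using (Σ; ∃; _×_; _,_; proj₁; proj₂)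
open import Data.Sum as Sum using (_⊎_; inj₁; inj₂; [_,_]′)
open import Data.Vec as Vec using (Vec; []; _∷_; zipWith)
import Data.Vec.Properties as VecP
open import Algebra.Properties.CommutativeSemigroup +-commutativeSemigroup
  using () renaming (interchange to +-interchange)
open import Function using (_∘_; flip; id)
open import Relation.Binary.Construct.Closure.ReflexiveTransitive using (Star; ε; _◅_; _◅◅_) renaming (reverse to Star-reverse)
open import Relation.Binary.PropositionalEquality hiding ([_])
open import Relation.Nullary using (¬_; ¬?; Dec; yes; no; does)
open import Relation.Nullary.Decidable using (_×-dec_; dec-true; dec-false; isYes≗does)

==-refl : ∀ {n} (a : Fin n) → (a == a) ≡ true
==-refl a = trans (isYes≗does (a Fin.≟ a)) (dec-true (a Fin.≟ a) refl)

==-≢ : ∀ {n} {a b : Fin n} → a ≢ b → (a == b) ≡ false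
==-≢ {a = a} {b} a≢b = trans (isYes≗does (a Fin.≟ b)) (dec-false (a Fin.≟ b) a≢b)

==⇒≡ : ∀ {n} {a b : Fin n} → (a == b) ≡ true → a ≡ b
==⇒≡ {a = a} {b} eq with a Fin.≟ b
... | yes a≡b = a≡b

data EqView {n} (a b : Fin n) : Set where
  equal    : a ≡ b → (a == b) ≡ true → EqView a b
  distinct : a ≢ b → (a == b) ≡ false → EqView a b

eqView : ∀ {n} (a b : Fin n) → EqView a b
eqView a b with a Fin.≟ b
... | yes refl = equal refl (==-refl a)
... | no a≢b   = distinct a≢b (==-≢ a≢b)

false≢true : false ≢ true
false≢true ()

∨-true : ∀ {a b : Bool} → (a ∨ b) ≡ true → a ≡ true ⊎ b ≡ true
∨-true {true}  _ = inj₁ refl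
∨-true {false} e = inj₂ e

∧-true : ∀ {a b : Bool} → (a ∧ b) ≡ true → a ≡ true × b ≡ true
∧-true {true} {true} _ = refl , refl

∧-intro : ∀ {a b : Bool} → a ≡ true → b ≡ true → (a ∧ b) ≡ true
∧-intro refl refl = refl

any-true⁻ : ∀ {A : Set} (p : A → Bool) xs → any p xs ≡ true → ∃ λ a → a ∈ xs × p a ≡ true
any-true⁻ p (a ∷ xs) any≡ with p a in pa
... | true  = a , here refl , pa
... | false = let b , b∈ , pb = any-true⁻ p xs any≡ in b , there b∈ , pb

any-true⁺ : ∀ {A : Set} (p : A → Bool) {xs a} → a ∈ xs → p a ≡ true → any p xs ≡ true
any-true⁺ p (here refl) pa rewrite pa = refl
any-true⁺ p {b ∷ _} (there a∈) pa rewrite any-true⁺ p a∈ pa = ∨-zeroʳ (p b)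

bool-ext : ∀ {a b : Bool} → (a ≡ true → b ≡ true) → (b ≡ true → a ≡ true) → a ≡ b
bool-ext {true}          a⇒b _ = sym (a⇒b refl)
bool-ext {false} {false} _   _ = refl
bool-ext {false} {true}  _ b⇒a = b⇒a refl

bit : Bool → ℕ
bit true  = 1
bit false = 0

sumFin : ∀ {n} → (Fin n → ℕ) → ℕ
sumFin {zero}  f = 0
sumFin {suc n} f = f zero + sumFin (f ∘ suc)

count : ∀ {n} → (Fin n → Bool) → ℕ
count f = sumFin (bit ∘ f)

sumFin-cong : ∀ {n} {f g : Fin n → ℕ} → (∀ i → f i ≡ g i) → sumFin f ≡ sumFin g
sumFin-cong {zero}  _   = refl
sumFin-cong {suc n} f≗g = cong₂ _+_ (f≗g zero) (sumFin-cong (f≗g ∘ suc))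

sumFin-+ : ∀ {n} (f g : Fin n → ℕ) → sumFin (λ i → f i + g i) ≡ sumFin f + sumFin g
sumFin-+ {zero}  f g = refl
sumFin-+ {suc n} f g =
  trans (cong (f zero + g zero +_) (sumFin-+ (f ∘ suc) (g ∘ suc))) (+-interchange (f zero) (g zero) _ _)

sumFin-update : ∀ {n} (f g : Fin n → ℕ) t → (∀ a → a ≢ t → f a ≡ g a) → sumFin f + g t ≡ sumFin g + f t
sumFin-update {suc n} f g zero f≈g = begin
  f zero + sumFin (f ∘ suc) + g zero ≡⟨ cong (λ S → f zero + S + g zero) (sumFin-cong (λ a → f≈g (suc a) λ ())) ⟩
  f zero + sumFin (g ∘ suc) + g zero ≡⟨ +-comm (f zero + _) (g zero) ⟩
  g zero + (f zero + sumFin (g ∘ suc)) ≡⟨ cong (g zero +_) (+-comm (f zero) _) ⟩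
  g zero + (sumFin (g ∘ suc) + f zero) ≡⟨ +-assoc (g zero) _ _ ⟨
  g zero + sumFin (g ∘ suc) + f zero ∎
  where open ≡-Reasoning
sumFin-update {suc n} f g (suc t) f≈g = begin
  f zero + sumFin (f ∘ suc) + g (suc t)   ≡⟨ +-assoc (f zero) _ _ ⟩
  f zero + (sumFin (f ∘ suc) + g (suc t)) ≡⟨ cong₂ _+_ (f≈g zero λ ()) (sumFin-update (f ∘ suc) (g ∘ suc) t f≈g-suc) ⟩
  g zero + (sumFin (g ∘ suc) + f (suc t)) ≡⟨ +-assoc (g zero) _ _ ⟨
  g zero + sumFin (g ∘ suc) + f (suc t)   ∎
  where
  open ≡-Reasoning
  f≈g-suc : ∀ a → a ≢ t → f (suc a) ≡ g (suc a)
  f≈g-suc a a≢t = f≈g (suc a) (a≢t ∘ FinP.suc-injective)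

count-cong : ∀ {n} {f g : Fin n → Bool} → (∀ a → f a ≡ g a) → count f ≡ count g
count-cong f≗g = sumFin-cong (cong bit ∘ f≗g)

count-allFalse : ∀ {n} (f : Fin n → Bool) → (∀ a → f a ≡ false) → count f ≡ 0
count-allFalse {zero}  f _     = refl
count-allFalse {suc n} f false! rewrite false! zero = count-allFalse (f ∘ suc) (false! ∘ suc)

count-∨ : ∀ {n} (f g : Fin n → Bool) → (∀ a → f a ≡ true → g a ≡ true → ⊥) →
  count (λ a → f a ∨ g a) ≡ count f + count g
count-∨ f g disjoint = trans (sumFin-cong bit-∨) (sumFin-+ (bit ∘ f) (bit ∘ g))
  where
  bit-∨ : ∀ a → bit (f a ∨ g a) ≡ bit (f a) + bit (g a)
  bit-∨ a with f a in fa | g a in ga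
  ... | true  | true  = ⊥-elim (disjoint a fa ga)
  ... | true  | false = refl
  ... | false | _     = refl

count-witness : ∀ {n} (f : Fin n → Bool) → 1 ≤ count f → ∃ λ a → f a ≡ true
count-witness {suc n} f 1≤ with f zero in f0
... | true  = zero , f0
... | false = let a , fa = count-witness (f ∘ suc) 1≤ in suc a , fa

count-witness₂ : ∀ {n} (f : Fin n → Bool) → 2 ≤ count f → ∃ λ a → ∃ λ b → a ≢ b × f a ≡ true × f b ≡ true
count-witness₂ {suc n} f 2≤ with f zero in f0
... | true  = let b , fb = count-witness (f ∘ suc) (s≤s⁻¹ 2≤) in zero , suc b , (λ ()) , f0 , fb
... | false = let a , b , a≢b , fa , fb = count-witness₂ (f ∘ suc) 2≤
              in suc a , suc b , a≢b ∘ FinP.suc-injective , fa , fb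

without : ∀ {n} → (Fin n → Bool) → Fin n → Fin n → Bool
without f t a = if a == t then false else f a

without-≢ : ∀ {n} (f : Fin n → Bool) {t} a → a ≢ t → without f t a ≡ f a
without-≢ f a a≢t rewrite ==-≢ a≢t = refl

count-without : ∀ {n} (f : Fin n → Bool) t → f t ≡ true → count f ≡ suc (count (without f t))
count-without f t ft = +-cancelʳ-≡ 0 _ _ (begin
  count f + 0                         ≡⟨ cong (λ b → count f + bit b) without-t ⟨
  count f + bit (without f t t)       ≡⟨ sumFin-update (bit ∘ f) (bit ∘ without f t) t
                                           (λ a a≢t → cong bit (sym (without-≢ f a a≢t))) ⟩
  count (without f t) + bit (f t)     ≡⟨ cong (λ b → count (without f t) + bit b) ft ⟩
  count (without f t) + 1             ≡⟨ +-comm _ 1 ⟩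
  suc (count (without f t))           ≡⟨ +-identityʳ _ ⟨
  suc (count (without f t)) + 0       ∎)
  where
  open ≡-Reasoning
  without-t : without f t t ≡ false
  without-t rewrite ==-refl t = refl

count-singleton : ∀ {n} (t : Fin n) → count (_== t) ≡ 1
count-singleton t = trans (count-without (_== t) t (==-refl t)) (cong suc (count-allFalse _ none))
  where
  none : ∀ a → without (_== t) t a ≡ false
  none a with eqView a t
  ... | equal _ a=t    rewrite a=t = refl
  ... | distinct _ a≠t rewrite a≠t = refl

count-witness₃ : ∀ {n} (f : Fin n → Bool) → 3 ≤ count f →
  ∃ λ a → ∃ λ b → ∃ λ c → a ≢ b × a ≢ c × b ≢ c × f a ≡ true × f b ≡ true × f c ≡ true
count-witness₃ {suc n} f 3≤ with f zero in f0
... | true  = let b , c , b≢c , fb , fc = count-witness₂ (f ∘ suc) (s≤s⁻¹ 3≤)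
              in zero , suc b , suc c , (λ ()) , (λ ()) , b≢c ∘ FinP.suc-injective , f0 , fb , fc
... | false = let a , b , c , a≢b , a≢c , b≢c , fa , fb , fc = count-witness₃ (f ∘ suc) 3≤
              in suc a , suc b , suc c , a≢b ∘ FinP.suc-injective , a≢c ∘ FinP.suc-injective ,
                 b≢c ∘ FinP.suc-injective , fa , fb , fc

count-mono : ∀ {n} (f g : Fin n → Bool) → (∀ a → f a ≡ true → g a ≡ true) → count f ≤ count g
count-mono {zero}  f g f⊆g = z≤n
count-mono {suc n} f g f⊆g with f zero in f0 | g zero in g0
... | true  | true  = s≤s (count-mono (f ∘ suc) (g ∘ suc) (f⊆g ∘ suc))
... | true  | false = ⊥-elim (false≢true (trans (sym g0) (f⊆g zero f0)))
... | false | true  = m≤n⇒m≤1+n (count-mono (f ∘ suc) (g ∘ suc) (f⊆g ∘ suc))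
... | false | false = count-mono (f ∘ suc) (g ∘ suc) (f⊆g ∘ suc)

count-mono-< : ∀ {n} (f g : Fin n → Bool) t → (∀ a → f a ≡ true → g a ≡ true) →
  g t ≡ true → f t ≡ false → count f < count g
count-mono-< f g t f⊆g gt ft = subst (count f <_) (sym (count-without g t gt)) (s≤s (count-mono f (without g t) f⊆g∖t))
  where
  f⊆g∖t : ∀ a → f a ≡ true → without g t a ≡ true
  f⊆g∖t a fa with eqView a t
  ... | equal refl _   = ⊥-elim (false≢true (trans (sym ft) fa))
  ... | distinct a≢t _ = trans (without-≢ g a a≢t) (f⊆g a fa)

count-≥1 : ∀ {n} (f : Fin n → Bool) {a} → f a ≡ true → 1 ≤ count f
count-≥1 f {a} fa rewrite count-without f a fa = s≤s z≤n

count-≥2 : ∀ {n} (f : Fin n → Bool) {a b} → a ≢ b → f a ≡ true → f b ≡ true → 2 ≤ count f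
count-≥2 f {a} {b} a≢b fa fb rewrite count-without f a fa =
  s≤s (count-≥1 (without f a) (trans (without-≢ f b (a≢b ∘ sym)) fb))

count≡2-members : ∀ {n} (f : Fin n → Bool) {a b} → count f ≡ 2 → a ≢ b → f a ≡ true → f b ≡ true →
  ∀ c → f c ≡ true → c ≡ a ⊎ c ≡ b
count≡2-members f {a} {b} count≡2 a≢b fa fb c fc with eqView c a | eqView c b
... | equal c≡a _    | _              = inj₁ c≡a
... | distinct _ _   | equal c≡b _    = inj₂ c≡b
... | distinct c≢a _ | distinct c≢b _ = ⊥-elim (3≰2 (subst (3 ≤_) count≡2 three))
  where
  3≰2 : ¬ 3 ≤ 2
  3≰2 (s≤s (s≤s ()))
  three : 3 ≤ count f
  three rewrite count-without f c fc =
    s≤s (count-≥2 (without f c) a≢b (trans (without-≢ f a (c≢a ∘ sym)) fa) (trans (without-≢ f b (c≢b ∘ sym)) fb))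

module _ {m : ℕ} (E : Arcs m) where

  countTrue-allFin : ∀ {n} (f : Fin n → Bool) → countTrue E (map f (allFin n)) ≡ count f
  countTrue-allFin {n} f = trans (cong (countTrue E) (map-tabulate {n = n} (λ i → i) f)) (countTrue-tabulate f)
    where
    countTrue-tabulate : ∀ {n} (f : Fin n → Bool) → countTrue E (tabulate f) ≡ count f
    countTrue-tabulate {zero}  f = refl
    countTrue-tabulate {suc n} f with f zero
    ... | true  = cong suc (countTrue-tabulate (f ∘ suc))
    ... | false = countTrue-tabulate (f ∘ suc)

  indeg-count : ∀ v → indeg E v ≡ count (λ u → E u v)
  indeg-count v = countTrue-allFin (λ u → E u v)

  outdeg-count : ∀ v → outdeg E v ≡ count (E v)
  outdeg-count v = countTrue-allFin (E v)

  numLeaves-count : numLeaves E ≡ count (isLeafB E)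
  numLeaves-count = countTrue-allFin (isLeafB E)

  numReticulations-count : numReticulations E ≡ count (λ v → indeg E v ≡ᵇ 2)
  numReticulations-count = countTrue-allFin (λ v → indeg E v ≡ᵇ 2)

  reticulation-parents : ∀ {v} → IsReticulation E v → ∃ λ u → ∃ λ u' → u ≢ u' × Arc E u v × Arc E u' v
  reticulation-parents {v} ret = count-witness₂ (λ u → E u v) (subst (2 ≤_) (trans (sym ret) (indeg-count v)) ≤-refl)

  isLeafB-false : ∀ {a b} → Arc E a b → isLeafB E a ≡ false
  isLeafB-false {a} {b} ab rewrite outdeg-count a | count-without (E a) b ab = refl

  isLeafB-true : ∀ {a} → (∀ b → E a b ≡ false) → isLeafB E a ≡ true
  isLeafB-true {a} no-arc rewrite outdeg-count a | count-allFalse (E a) no-arc = refl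

  isLeafB-noArc : ∀ {a} → isLeafB E a ≡ true → ∀ b → E a b ≡ false
  isLeafB-noArc {a} leaf b with E a b in ab
  ... | false = refl
  ... | true  = ⊥-elim (false≢true (trans (sym (isLeafB-false ab)) leaf))

isLeafB-cong : ∀ {m n} (E : Arcs m) (F : Arcs n) {a a'} →
  (∀ b → Arc E a b → ∃ (Arc F a')) → (∀ b' → Arc F a' b' → ∃ (Arc E a)) → isLeafB F a' ≡ isLeafB E a
isLeafB-cong E F E⇒F F⇒E = bool-ext (leaf-transfer E F E⇒F) (leaf-transfer F E F⇒E)
  where
  leaf-transfer : ∀ {m n} (E : Arcs m) (F : Arcs n) {a a'} →
    (∀ b → Arc E a b → ∃ (Arc F a')) → isLeafB F a' ≡ true → isLeafB E a ≡ true
  leaf-transfer E F {a} {a'} E⇒F leaf = isLeafB-true E no-arc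
    where
    no-arc : ∀ b → E a b ≡ false
    no-arc b with E a b in ab
    ... | false = refl
    ... | true  = let b' , a'b' = E⇒F b ab in ⊥-elim (false≢true (trans (sym (isLeafB-noArc F leaf b')) a'b'))

unique-length : ∀ {m} {xs : List (Fin m)} → Unique xs → length xs ≤ m
unique-length {m} {xs} uniq with length xs ≤? m
... | yes ≤m = ≤m
... | no  ≰m = let i , j , i<j , xsᵢ≡xsⱼ = FinP.pigeonhole (≰⇒> ≰m) (lookup xs)
               in ⊥-elim (lookup-injective uniq i j i<j xsᵢ≡xsⱼ)
  where
  lookup-injective : ∀ {xs : List (Fin m)} → Unique xs → ∀ i j → i Fin.< j → lookup xs i ≢ lookup xs j
  lookup-injective (x∉ ∷ _)    zero    (suc j) _   = All.lookup x∉ (∈-lookup j)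
  lookup-injective (_ ∷ uniq) (suc i) (suc j) i<j = lookup-injective uniq i j (s≤s⁻¹ i<j)

lastOf : ∀ {A : Set} → A → List A → A
lastOf a []       = a
lastOf a (b ∷ xs) = lastOf b xs

lastOf-∈ : ∀ {A : Set} (a : A) xs → lastOf a xs ∈ a ∷ xs
lastOf-∈ a []       = here refl
lastOf-∈ a (b ∷ xs) = there (lastOf-∈ b xs)

lastOf-snoc : ∀ {A : Set} (a : A) xs b → lastOf a (xs ++ [ b ]) ≡ b
lastOf-snoc a []       b = refl
lastOf-snoc a (c ∷ xs) b = lastOf-snoc c xs b

lastOf-ʳ++ : ∀ {A : Set} (a : A) xs c acc → lastOf a (xs ʳ++ c ∷ acc) ≡ lastOf c acc
lastOf-ʳ++ a []       c acc = refl
lastOf-ʳ++ a (x ∷ xs) c acc = lastOf-ʳ++ a xs x (c ∷ acc)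

module _ {m : ℕ} (E : Arcs m) where

  open DecMembership (Fin._≟_ {m}) using (_∈?_)

  chain-first : ∀ t is v → Chain E (t ∷ is ++ [ v ]) → Arc E t (secondOf E is v)
  chain-first t []      v (tv , _) = tv
  chain-first t (_ ∷ _) v (ti , _) = ti

  chain-reach : ∀ {a} xs → Chain E (a ∷ xs) → Reach E a (lastOf a xs)
  chain-reach []       _         = ε
  chain-reach (b ∷ xs) (ab , ch) = ab ◅ chain-reach xs ch

  chain-∈-reach : ∀ {a x} xs → Chain E (a ∷ xs) → x ∈ a ∷ xs → Reach E x (lastOf a xs)
  chain-∈-reach xs       ch        (here refl) = chain-reach xs ch
  chain-∈-reach (b ∷ xs) (_ , ch) (there x∈)  = chain-∈-reach xs ch x∈

  chain-reach-∈ : ∀ {a x} xs → Chain E (a ∷ xs) → x ∈ a ∷ xs → Reach E a x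
  chain-reach-∈ xs       _         (here refl) = ε
  chain-reach-∈ (b ∷ xs) (ab , ch) (there x∈)  = ab ◅ chain-reach-∈ xs ch x∈

  chain-reach-end : ∀ t is v → Chain E (t ∷ is ++ [ v ]) → Reach E t v
  chain-reach-end t is v ch = subst (Reach E t) (lastOf-snoc t is v) (chain-reach (is ++ [ v ]) ch)

  chain-unique : Acyclic E → ∀ {a} xs → Chain E (a ∷ xs) → Unique (a ∷ xs)
  chain-unique ac []       _         = [] ∷ []
  chain-unique ac (b ∷ xs) (ab , ch) =
    All.tabulate (λ x∈ a≡x → ac _ b ab (subst (Reach E b) (sym a≡x) (chain-reach-∈ xs ch x∈))) ∷ chain-unique ac xs ch

  chain-endpoints-≢ : Acyclic E → ∀ t is v → Chain E (t ∷ is ++ [ v ]) → t ≢ v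
  chain-endpoints-≢ ac t []       v (tv , _)  refl = ac t t tv ε
  chain-endpoints-≢ ac t (i ∷ is) v (ti , ch) refl = ac t i ti (chain-reach-end i is v ch)

  chain-snoc : ∀ {a w b} xs → Chain E (a ∷ xs) → lastOf a xs ≡ w → Arc E w b → Chain E (a ∷ xs ++ [ b ])
  chain-snoc []       _         refl ab = ab , _
  chain-snoc (c ∷ xs) (ab , ch) end  wb = ab , chain-snoc xs ch end wb

  reach⇒chain : ∀ {a b} → Reach E a b → Σ (List (Fin m)) λ xs → Chain E (a ∷ xs) × lastOf a xs ≡ b
  reach⇒chain ε        = [] , _ , refl
  reach⇒chain (ab ◅ p) = let xs , ch , end = reach⇒chain p in _ ∷ xs , (ab , ch) , end

  chain-suffix : ∀ {a t} xs → Chain E (a ∷ xs) → t ∈ a ∷ xs →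
    Σ (List (Fin m)) λ ys → Chain E (t ∷ ys) × lastOf t ys ≡ lastOf a xs × (∀ {x} → x ∈ ys → x ∈ a ∷ xs)
  chain-suffix xs       ch       (here refl) = xs , ch , refl , there
  chain-suffix (b ∷ xs) (_ , ch) (there t∈)  =
    let ys , ch' , end , ys⊆ = chain-suffix xs ch t∈ in ys , ch' , end , there ∘ ys⊆

  LastVisit : List (Fin m) → Fin m → List (Fin m) → Set
  LastVisit S a xs = Σ (Fin m) λ t → t ∈ S × Σ (List (Fin m)) λ ys →
    Chain E (t ∷ ys) × lastOf t ys ≡ lastOf a xs × All (_∉ S) ys

  lastVisit : ∀ S {a} xs → Chain E (a ∷ xs) → All (_∉ S) (a ∷ xs) ⊎ LastVisit S a xs
  lastVisit S {a} [] _ with a ∈? S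
  ... | yes a∈ = inj₂ (a , a∈ , [] , _ , refl , [])
  ... | no  a∉ = inj₁ (a∉ ∷ [])
  lastVisit S {a} (b ∷ xs) (ab , ch) with lastVisit S xs ch
  ... | inj₂ visit = inj₂ visit
  ... | inj₁ b∷xs∉ with a ∈? S
  ...   | yes a∈ = inj₂ (a , a∈ , b ∷ xs , (ab , ch) , refl , b∷xs∉)
  ...   | no  a∉ = inj₁ (a∉ ∷ b∷xs∉)

  record TopVertex (u u' : Fin m) : Set where
    field
      top         : Fin m
      left right  : List (Fin m)
      left-chain  : Chain E (top ∷ left)
      right-chain : Chain E (top ∷ right)
      left-end    : lastOf top left ≡ u
      right-end   : lastOf top right ≡ u'
      disjoint    : Disjoint E left right

  topVertex : ∀ {ρ u u'} → Reach E ρ u → Reach E ρ u' → TopVertex u u'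
  topVertex {ρ} p p' with reach⇒chain p | reach⇒chain p'
  ... | xs , ch , end | xs' , ch' , end' with lastVisit (ρ ∷ xs) xs' ch'
  ... | inj₁ (ρ∉ ∷ _) = ⊥-elim (ρ∉ (here refl))
  ... | inj₂ (t , t∈ , ys' , ch₂ , end₂ , ys'∉) with chain-suffix xs ch t∈
  ... | ys , ch₁ , end₁ , ys⊆ = record
    { top = t ; left = ys ; right = ys' ; left-chain = ch₁ ; right-chain = ch₂
    ; left-end = trans end₁ end ; right-end = trans end₂ end'
    ; disjoint = λ w w∈ys w∈ys' → All.lookup ys'∉ w∈ys' (ys⊆ w∈ys) }

  reticulationCycle : Acyclic E → ∀ {v u u'} → IsReticulation E v → Arc E u v → Arc E u' v → u ≢ u' →
    (T : TopVertex u u') → let open TopVertex T in RetCycle E top v (secondOf E left v) (secondOf E right v)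
  reticulationCycle ac {v} {u} {u'} ret uv u'v u≢u' T =
    ret , left , right , chain-snoc left left-chain left-end uv , chain-snoc right right-chain right-end u'v ,
    disjoint , refl , refl ,
    second-≢ left right left-chain right-chain left-end right-end disjoint
    where
    open TopVertex T
    second-≢ : ∀ xs ys → Chain E (top ∷ xs) → Chain E (top ∷ ys) → lastOf top xs ≡ u → lastOf top ys ≡ u' →
      Disjoint E xs ys → secondOf E xs v ≢ secondOf E ys v
    second-≢ []       []       _  _  end end' _ _    = u≢u' (trans (sym end) end')
    second-≢ (x ∷ xs) []       ch _  end _    _ refl = ac u v uv (subst (Reach E v) end (chain-reach xs (proj₂ ch)))
    second-≢ []       (y ∷ ys) _  ch _   end' _ refl = ac u' v u'v (subst (Reach E v) end' (chain-reach ys (proj₂ ch)))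
    second-≢ (x ∷ xs) (y ∷ ys) _  _  _   _    dj x≡y = dj x (here refl) (here x≡y)

  secondOf-ʳ++ : ∀ xs c acc b → secondOf E (xs ʳ++ c ∷ acc) b ≡ lastOf c xs
  secondOf-ʳ++ []       c acc b = refl
  secondOf-ʳ++ (x ∷ xs) c acc b = secondOf-ʳ++ xs x (c ∷ acc) b

  unique-ʳ++ : ∀ xs {acc} → Unique xs → Unique acc → Disjoint E xs acc → Unique (xs ʳ++ acc)
  unique-ʳ++ []       _          uacc _  = uacc
  unique-ʳ++ (x ∷ xs) (x∉ ∷ uxs) uacc dj = unique-ʳ++ xs uxs
    (All.tabulate (λ w∈ x≡w → dj x (here refl) (subst (_∈ _) (sym x≡w) w∈)) ∷ uacc)
    λ { w w∈ (here refl) → All.lookup x∉ w∈ refl ; w w∈ (there w∈') → dj w (there w∈) w∈' }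

  adjChain-ʳ++ : ∀ a xs acc → AdjChain E (a ∷ xs) → AdjChain E (a ∷ acc) → AdjChain E (xs ʳ++ a ∷ acc)
  adjChain-ʳ++ a []       acc _            adj = adj
  adjChain-ʳ++ a (x ∷ xs) acc (ax , adjxs) adj = adjChain-ʳ++ x xs (a ∷ acc) adjxs (Sum.swap ax , adj)

  chain⇒adjChain : ∀ xs → Chain E xs → AdjChain E xs
  chain⇒adjChain []           _         = _
  chain⇒adjChain (_ ∷ [])     _         = _
  chain⇒adjChain (_ ∷ b ∷ xs) (ab , ch) = inj₁ ab , chain⇒adjChain (b ∷ xs) ch

  cycleEdges-last : ∀ a xs → (lastOf a xs , a) ∈ cycleEdges E (a ∷ xs)
  cycleEdges-last a xs = go a xs
    where
    go : ∀ b xs → (lastOf b xs , a) ∈ zip (b ∷ xs) (xs ++ [ a ])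
    go b []       = here refl
    go b (c ∷ xs) = there (go c xs)

  cycleEdges-first : ∀ a xs → (a , secondOf E xs a) ∈ cycleEdges E (a ∷ xs)
  cycleEdges-first a []      = here refl
  cycleEdges-first a (_ ∷ _) = here refl

  cycleEdges-into : ∀ {b} a xs → a ∉ xs → (b , a) ∈ cycleEdges E (a ∷ xs) → b ≡ lastOf a xs
  cycleEdges-into a xs a∉ = go a xs a∉
    where
    go : ∀ {b} c xs → a ∉ xs → (b , a) ∈ zip (c ∷ xs) (xs ++ [ a ]) → b ≡ lastOf c xs
    go c []       _  (here refl) = refl
    go c (d ∷ xs) a∉ (here refl) = ⊥-elim (a∉ (here refl))
    go c (d ∷ xs) a∉ (there e∈)  = go d xs (a∉ ∘ there) e∈

  cycleEdges-from : ∀ {b} a xs → a ∉ xs → (a , b) ∈ cycleEdges E (a ∷ xs) → b ≡ secondOf E xs a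
  cycleEdges-from a []       _  (here refl) = refl
  cycleEdges-from a (c ∷ xs) _  (here refl) = refl
  cycleEdges-from a (c ∷ xs) a∉ (there e∈)  = ⊥-elim (a∉ (zip-fst (c ∷ xs) e∈))
    where
    zip-fst : ∀ {x y} xs {ys} → (x , y) ∈ zip xs ys → x ∈ xs
    zip-fst (_ ∷ _)  {_ ∷ _} (here refl) = here refl
    zip-fst (_ ∷ xs) {_ ∷ _} (there e∈)  = there (zip-fst xs e∈)

  module ReticulationCycle (ac : Acyclic E) {v u u'} (uv : Arc E u v) (u'v : Arc E u' v) (u≢u' : u ≢ u')
                           (T : TopVertex u u') where
    open TopVertex T

    -- v followed by the reversed right path and the left path: an undirected cycle through u', top and u.
    cycle : List (Fin m)
    cycle = right ʳ++ top ∷ left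

    cycle-last : lastOf v cycle ≡ u
    cycle-last = trans (lastOf-ʳ++ v right top left) left-end

    cycle-second : secondOf E cycle v ≡ u'
    cycle-second = trans (secondOf-ʳ++ right top left v) right-end

    ∈-cycle : ∀ {w} → w ∈ top ∷ left ⊎ w ∈ right → w ∈ cycle
    ∈-cycle = reverseAcc⁺ (top ∷ left) right

    v∉cycle : v ∉ cycle
    v∉cycle v∈ with reverseAcc⁻ (top ∷ left) right v∈
    ... | inj₁ v∈left  = ac u v uv (subst (Reach E v) left-end (chain-∈-reach left left-chain v∈left))
    ... | inj₂ v∈right = ac u' v u'v (subst (Reach E v) right-end (chain-∈-reach right right-chain (there v∈right)))

    cycle-unique : Unique cycle
    cycle-unique with chain-unique ac right right-chain
    ... | top∉right ∷ unique-right = unique-ʳ++ right unique-right (chain-unique ac left left-chain) right∩left=∅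
      where
      right∩left=∅ : Disjoint E right (top ∷ left)
      right∩left=∅ w w∈right (here refl)   = All.lookup top∉right w∈right refl
      right∩left=∅ w w∈right (there w∈left) = disjoint w w∈left w∈right

    cycle-length : 2 ≤ length cycle
    cycle-length = two-distinct (∈-cycle (inj₁ (subst (_∈ top ∷ left) left-end (lastOf-∈ top left)))) u'∈ u≢u'
      where
      u'∈ : u' ∈ cycle
      u'∈ with subst (_∈ top ∷ right) right-end (lastOf-∈ top right)
      ... | here u'≡top     = ∈-cycle (inj₁ (here u'≡top))
      ... | there u'∈right = ∈-cycle (inj₂ u'∈right)
      two-distinct : ∀ {a b xs} → a ∈ xs → b ∈ xs → a ≢ b → 2 ≤ length xs
      two-distinct {xs = _ ∷ []}    (here refl) (here refl) a≢b = ⊥-elim (a≢b refl)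
      two-distinct {xs = _ ∷ _ ∷ _} _           _           _   = s≤s (s≤s z≤n)

    cycle-adjacent : AdjChain E (v ∷ cycle ++ [ v ])
    cycle-adjacent = subst (AdjChain E) reorder (adjChain-ʳ++ top (right ++ [ v ]) (left ++ [ v ])
      (chain⇒adjChain _ (chain-snoc right right-chain right-end u'v))
      (chain⇒adjChain _ (chain-snoc left left-chain left-end uv)))
      where
      reorder : (right ++ [ v ]) ʳ++ top ∷ left ++ [ v ] ≡ v ∷ cycle ++ [ v ]
      reorder = trans (++-ʳ++ right) (cong (v ∷_) (trans (ʳ++-defn right)
        (trans (sym (++-assoc (reverse right) (top ∷ left) [ v ])) (cong (_++ [ v ]) (sym (ʳ++-defn right))))))

    isCycle : IsCycle E (v ∷ cycle)
    isCycle = s≤s cycle-length , All.tabulate (λ w∈ v≡w → v∉cycle (subst (_∈ cycle) (sym v≡w) w∈)) ∷ cycle-unique ,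
              cycle-adjacent

    edge-u : EdgeOf E u v (v ∷ cycle)
    edge-u = _ , subst (λ w → (w , v) ∈ cycleEdges E (v ∷ cycle)) cycle-last (cycleEdges-last v cycle) , inj₁ refl

    edge-u' : EdgeOf E u' v (v ∷ cycle)
    edge-u' = _ , subst (λ w → (v , w) ∈ cycleEdges E (v ∷ cycle)) cycle-second (cycleEdges-first v cycle) , inj₂ refl

    edge-into-v : ∀ {a} → EdgeOf E a v (v ∷ cycle) → a ≡ u ⊎ a ≡ u'
    edge-into-v (_ , e∈ , inj₁ refl) = inj₁ (trans (cycleEdges-into v cycle v∉cycle e∈) cycle-last)
    edge-into-v (_ , e∈ , inj₂ refl) = inj₂ (trans (cycleEdges-from v cycle v∉cycle e∈) cycle-second)

cactus-indeg≤2 : ∀ {m} (E : Arcs m) ρ → IsRootedCactus E ρ → ∀ v → indeg E v ≤ 2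
cactus-indeg≤2 E ρ (ac , _ , _ , rooted , _ , edge-disjoint) v with indeg E v ≤? 2
... | yes ≤2 = ≤2
... | no  ≰2 = three-parents (count-witness₃ (λ a → E a v) (subst (3 ≤_) (indeg-count E v) (≰⇒> ≰2)))
  where
  three-parents : (∃ λ a → ∃ λ b → ∃ λ c → a ≢ b × a ≢ c × b ≢ c × Arc E a v × Arc E b v × Arc E c v) →
                  indeg E v ≤ 2
  three-parents (u₁ , u₂ , u₃ , u₁≢u₂ , u₁≢u₃ , u₂≢u₃ , u₁v , u₂v , u₃v) =
    ⊥-elim ([ u₁≢u₂ ∘ sym , u₂≢u₃ ]′ (C₁₃.edge-into-v u₂v-on-C₁₃))
    where
    module C₁₂ = ReticulationCycle E ac u₁v u₂v u₁≢u₂ (topVertex E (rooted u₁) (rooted u₂))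
    module C₁₃ = ReticulationCycle E ac u₁v u₃v u₁≢u₃ (topVertex E (rooted u₁) (rooted u₃))
    u₂v-on-C₁₃ : EdgeOf E u₂ v (v ∷ C₁₃.cycle)
    u₂v-on-C₁₃ =
      proj₁ (edge-disjoint _ _ C₁₂.isCycle C₁₃.isCycle (u₁ , v , C₁₂.edge-u , C₁₃.edge-u) u₂ v) C₁₂.edge-u'

module _ {m : ℕ} (E : Arcs m) where

  acyclic-antisym : Acyclic E → ∀ {a b} → a ≢ b → Reach E a b → Reach E b a → ⊥
  acyclic-antisym ac a≢b ε         _  = a≢b refl
  acyclic-antisym ac _   (ab ◅ bc) ca = ac _ _ ab (bc ◅◅ ca)

  pathLength : ∀ {a b} → Reach E a b → ℕ
  pathLength = length ∘ proj₁ ∘ reach⇒chain E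

  pathLength< : Acyclic E → ∀ {a b} (p : Reach E a b) → pathLength p < m
  pathLength< ac p = let xs , ch , _ = reach⇒chain E p in unique-length (chain-unique E ac xs ch)

  reachWithin : ℕ → Fin m → Fin m → Bool
  reachWithin zero    a b = a == b
  reachWithin (suc f) a b = (a == b) ∨ any (λ c → E a c ∧ reachWithin f c b) (allFin m)

  reachWithin-sound : ∀ f a b → reachWithin f a b ≡ true → Reach E a b
  reachWithin-sound zero    a b a=b rewrite ==⇒≡ a=b = ε
  reachWithin-sound (suc f) a b within with ∨-true {a == b} within
  ... | inj₁ a=b rewrite ==⇒≡ a=b = ε
  ... | inj₂ via with any-true⁻ _ (allFin m) via
  ... | c , _ , ac∧cb = proj₁ (∧-true ac∧cb) ◅ reachWithin-sound f c b (proj₂ (∧-true ac∧cb))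

  reachWithin-complete : ∀ {a b} (p : Reach E a b) f → pathLength p ≤ f → reachWithin f a b ≡ true
  reachWithin-complete {a} ε zero    _ = ==-refl a
  reachWithin-complete {a} ε (suc f) _ rewrite ==-refl a = refl
  reachWithin-complete {a} {b} (_◅_ {j = c} arc p) (suc f) (s≤s ≤f) =
    trans (cong ((a == b) ∨_) (any-true⁺ _ (∈-allFin c) (∧-intro arc (reachWithin-complete p f ≤f)))) (∨-zeroʳ (a == b))

  reach? : Acyclic E → ∀ a b → Dec (Reach E a b)
  reach? ac a b with reachWithin m a b in within
  ... | true  = yes (reachWithin-sound m a b within)
  ... | false = no λ p → false≢true (trans (sym within) (reachWithin-complete p m (<⇒≤ (pathLength< ac p))))

-- Step (A)

labelledS? : (l : Maybe Label) → Dec (l ≡ just Label.s)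
labelledS? nothing        = no λ ()
labelledS? (just Label.x) = no λ ()
labelledS? (just Label.y) = no λ ()
labelledS? (just Label.z) = no λ ()
labelledS? (just Label.q) = no λ ()
labelledS? (just Label.r) = no λ ()
labelledS? (just Label.s) = yes refl

-- The termination measure of step (A).
unlabelledOutdeg : LGraph → ℕ
unlabelledOutdeg G = sumFin (λ v → if does (labelledS? (label G v)) then 0 else outdeg (arcs G) v)

module AddA (G : LGraph) {t w w' : Fin (size G)} (tw : Arc (arcs G) t w) (tw' : Arc (arcs G) t w') (w≢w' : w ≢ w') where

  private
    E : Arcs (size G)
    E = arcs G
    E⁺ : Arcs (suc (size G))
    E⁺ = arcs (addA G t w w')

  toW : Fin (size G) → Bool
  toW b = (b == w) ∨ (b == w')

  toW-arc : ∀ {b} → toW b ≡ true → Arc E t b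
  toW-arc {b} toWb with eqView b w | eqView b w'
  ... | equal refl _ | _            = tw
  ... | distinct _ _ | equal refl _ = tw'
  ... | distinct _ b≠w | distinct _ b≠w' rewrite b≠w | b≠w' = ⊥-elim (false≢true toWb)

  arc-old : ∀ {a b} → Arc E⁺ (suc a) (suc b) → Arc E a b
  arc-old {a} {b} ab with (a == t) ∧ toW b
  ... | true  = ⊥-elim (false≢true ab)
  ... | false = ab

  arc-new : ∀ {a b} → ((a == t) ∧ toW b) ≡ false → Arc E a b → Arc E⁺ (suc a) (suc b)
  arc-new {a} {b} kept ab rewrite kept = ab

  collapse : Fin (suc (size G)) → Fin (size G)
  collapse zero    = t
  collapse (suc a) = a

  reach-collapse : ∀ {a b} → Reach E⁺ a b → Reach E (collapse a) (collapse b)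
  reach-collapse ε = ε
  reach-collapse (_◅_ {zero}  {zero}  () _)
  reach-collapse (_◅_ {zero}  {suc b} 0b p) = toW-arc 0b ◅ reach-collapse p
  reach-collapse (_◅_ {suc a} {zero}  a0 p) rewrite ==⇒≡ a0 = reach-collapse p
  reach-collapse (_◅_ {suc a} {suc b} ab p) = arc-old ab ◅ reach-collapse p

  acyclic⁺ : Acyclic E → Acyclic E⁺
  acyclic⁺ ac zero    zero    () _
  acyclic⁺ ac zero    (suc b) 0b p = ac t b (toW-arc 0b) (reach-collapse p)
  acyclic⁺ ac (suc a) zero    a0 (_◅_ {j = zero}  () _)
  acyclic⁺ ac (suc a) zero    a0 (_◅_ {j = suc c} 0c p) rewrite ==⇒≡ a0 = ac t c (toW-arc 0c) (reach-collapse p)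
  acyclic⁺ ac (suc a) (suc b) ab p = ac a b (arc-old ab) (reach-collapse p)

  -- An arc t → w or t → w' is replaced by the detour through the new vertex.
  reach-lift : ∀ {a b} → Reach E a b → Reach E⁺ (suc a) (suc b)
  reach-lift ε = ε
  reach-lift (_◅_ {a} {b} ab p) = lift-arc ◅◅ reach-lift p
    where
    lift-arc : Reach E⁺ (suc a) (suc b)
    lift-arc with eqView a t | toW b in toWb
    ... | equal refl _    | true  = _◅_ {j = zero} (==-refl t) (_◅_ {j = suc b} toWb ε)
    ... | equal refl a=t  | false = arc-new (cong₂ _∧_ a=t toWb) ab ◅ ε
    ... | distinct _ a≠t  | _     = arc-new (cong (_∧ toW b) a≠t) ab ◅ ε

  rooted⁺ : (∀ v → Reach E (root G) v) → ∀ v → Reach E⁺ (root (addA G t w w')) v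
  rooted⁺ rooted zero    = reach-lift (rooted t) ◅◅ (==-refl t ◅ ε)
  rooted⁺ rooted (suc v) = reach-lift (rooted v)

  indeg-new : indeg E⁺ zero ≡ 1
  indeg-new = trans (indeg-count E⁺ zero) (count-singleton t)

  indeg-old : ∀ b → indeg E⁺ (suc b) ≡ indeg E b
  indeg-old b = trans (indeg-count E⁺ (suc b)) (trans (by-toW (toW b) refl) (sym (indeg-count E b)))
    where
    by-toW : ∀ c → toW b ≡ c → bit c + count (λ a → if (a == t) ∧ c then false else E a b) ≡ count (λ a → E a b)
    by-toW true  toWb = sym (trans (count-without (λ a → E a b) t (toW-arc toWb))
      (cong suc (count-cong λ a → cong (λ c → if c then false else E a b) (sym (∧-identityʳ (a == t))))))
    by-toW false _    = count-cong λ a → cong (λ c → if c then false else E a b) (∧-zeroʳ (a == t))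

  indeg≤2⁺ : (∀ v → indeg E v ≤ 2) → ∀ v → indeg E⁺ v ≤ 2
  indeg≤2⁺ _  zero    rewrite indeg-new  = s≤s z≤n
  indeg≤2⁺ ≤2 (suc v) rewrite indeg-old v = ≤2 v

  isLeafB-new : isLeafB E⁺ zero ≡ false
  isLeafB-new = isLeafB-false E⁺ {zero} {suc w} (cong (_∨ (w == w')) (==-refl w))

  isLeafB-old : ∀ a → isLeafB E⁺ (suc a) ≡ isLeafB E a
  isLeafB-old a = isLeafB-cong E E⁺ {a} {suc a} out-old out-new
    where
    out-old : ∀ b → Arc E a b → ∃ (Arc E⁺ (suc a))
    out-old b ab with eqView a t
    ... | equal refl _   = zero , ==-refl t
    ... | distinct _ a≠t = suc b , arc-new (cong (_∧ toW b) a≠t) ab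
    out-new : ∀ b → Arc E⁺ (suc a) b → ∃ (Arc E a)
    out-new zero    a0 rewrite ==⇒≡ a0 = w , tw
    out-new (suc b) ab = b , arc-old ab

  numLeaves-addA : numLeaves E⁺ ≡ numLeaves E
  numLeaves-addA = trans (numLeaves-count E⁺)
    (trans (cong₂ (λ l n → bit l + n) isLeafB-new (count-cong isLeafB-old)) (sym (numLeaves-count E)))

  numReticulations-addA : numReticulations E⁺ ≡ numReticulations E
  numReticulations-addA = trans (numReticulations-count E⁺)
    (trans (cong₂ (λ d n → bit (d ≡ᵇ 2) + n) indeg-new (count-cong (cong (_≡ᵇ 2) ∘ indeg-old)))
           (sym (numReticulations-count E)))

  private
    otherOut : ℕ
    otherOut = count (λ b → if toW b then false else E t b)

  outdeg-top : outdeg E t ≡ 2 + otherOut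
  outdeg-top = trans (outdeg-count E t) (trans (count-without (E t) w tw) (cong suc (trans
    (count-without (without (E t) w) w' (trans (without-≢ (E t) w' (w≢w' ∘ sym)) tw')) (cong suc (count-cong removed)))))
    where
    removed : ∀ b → without (without (E t) w) w' b ≡ (if toW b then false else E t b)
    removed b with b == w | b == w'
    ... | true  | true  = refl
    ... | true  | false = refl
    ... | false | true  = refl
    ... | false | false = refl

  outdeg⁺-top : outdeg E⁺ (suc t) ≡ 1 + otherOut
  outdeg⁺-top = trans (outdeg-count E⁺ (suc t)) (cong₂ _+_ (cong bit (==-refl t))
    (count-cong λ b → cong (λ c → if c ∧ toW b then false else E t b) (==-refl t)))

  outdeg⁺-old : ∀ a → a ≢ t → outdeg E⁺ (suc a) ≡ outdeg E a
  outdeg⁺-old a a≢t = trans (outdeg-count E⁺ (suc a)) (trans (cong₂ _+_ (cong bit (==-≢ a≢t))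
    (count-cong λ b → cong (λ c → if c ∧ toW b then false else E a b) (==-≢ a≢t))) (sym (outdeg-count E a)))

  unlabelledOutdeg-addA : label G t ≢ just Label.s → unlabelledOutdeg G ≡ suc (unlabelledOutdeg (addA G t w w'))
  unlabelledOutdeg-addA t≢s = +-cancelʳ-≡ otherOut _ _ (suc-injective (begin
    suc (sumFin F + otherOut)        ≡⟨ +-suc (sumFin F) otherOut ⟨
    sumFin F + (1 + otherOut)        ≡⟨ cong (sumFin F +_) F⁺-top ⟨
    sumFin F + F⁺ t                  ≡⟨ sumFin-update F F⁺ t F≈F⁺ ⟩
    sumFin F⁺ + F t                  ≡⟨ cong (sumFin F⁺ +_) F-top ⟩
    sumFin F⁺ + (2 + otherOut)       ≡⟨ +-suc (sumFin F⁺) (suc otherOut) ⟩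
    suc (sumFin F⁺ + suc otherOut)   ≡⟨ cong suc (+-suc (sumFin F⁺) otherOut) ⟩
    suc (suc (sumFin F⁺ + otherOut)) ∎))
    where
    open ≡-Reasoning
    F F⁺ : Fin (size G) → ℕ
    F  a = if does (labelledS? (label G a)) then 0 else outdeg E a
    F⁺ a = if does (labelledS? (label G a)) then 0 else outdeg E⁺ (suc a)
    unlabelled : does (labelledS? (label G t)) ≡ false
    unlabelled = dec-false (labelledS? (label G t)) t≢s
    F-top : F t ≡ 2 + otherOut
    F-top = trans (cong (if_then 0 else outdeg E t) unlabelled) outdeg-top
    F≈F⁺ : ∀ a → a ≢ t → F a ≡ F⁺ a
    F≈F⁺ a a≢t = cong (if does (labelledS? (label G a)) then 0 else_) (sym (outdeg⁺-old a a≢t))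
    F⁺-top : F⁺ t ≡ 1 + otherOut
    F⁺-top = trans (cong (if_then 0 else outdeg E⁺ (suc t)) unlabelled) outdeg⁺-top

-- Step (B')

module AddB (G : LGraph) {t v u u' : Fin (size G)} (ac : Acyclic (arcs G)) (ret : IsReticulation (arcs G) v)
            (uv : Arc (arcs G) u v) (u'v : Arc (arcs G) u' v) (u≢u' : u ≢ u') (tv : Reach (arcs G) t v) (t≢v : t ≢ v) where

  private
    E : Arcs (size G)
    E = arcs G
    E⁺ : Arcs (suc (suc (size G)))
    E⁺ = arcs (addB G t v u u')

  parent-of-v : ∀ {a} → Arc E a v → a ≡ u ⊎ a ≡ u'
  parent-of-v {a} av = count≡2-members (λ a → E a v) (trans (sym (indeg-count E v)) ret) u≢u' uv u'v a av

  top-has-child : ∃ (Arc E t)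
  top-has-child = first-arc tv t≢v
    where
    first-arc : ∀ {a} → Reach E a v → a ≢ v → ∃ (Arc E a)
    first-arc ε        a≢v = ⊥-elim (a≢v refl)
    first-arc (ab ◅ _) _   = _ , ab

  arc-old : ∀ a b → Arc E⁺ (suc (suc a)) (suc (suc b)) → (a ≡ t × b ≡ v) ⊎ Arc E a b
  arc-old a b ab with eqView a t | eqView b v
  ... | equal a≡t _    | equal b≡v _    = inj₁ (a≡t , b≡v)
  ... | equal _ a=t    | distinct _ b≠v rewrite a=t | b≠v = inj₂ ab
  ... | distinct _ a≠t | distinct _ b≠v rewrite a≠t | b≠v = inj₂ ab
  ... | distinct _ a≠t | equal _ b=v    rewrite a≠t | b=v with (a == u) ∨ (a == u')
  ...   | true  = ⊥-elim (false≢true ab)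
  ...   | false = inj₂ ab

  arc-not-into-v : ∀ a b → b ≢ v → E⁺ (suc (suc a)) (suc (suc b)) ≡ E a b
  arc-not-into-v a b b≢v rewrite ==-≢ b≢v | ∧-zeroʳ (a == t) = refl

  arc-new : ∀ {a b} → Arc E a b → Arc E⁺ (suc (suc a)) (suc (suc b)) ⊎ b ≡ v
  arc-new {a} {b} ab with eqView b v
  ... | equal b≡v _    = inj₂ b≡v
  ... | distinct b≢v _ = inj₁ (trans (arc-not-into-v a b b≢v) ab)

  collapse : Fin (suc (suc (size G))) → Fin (size G)
  collapse zero          = u
  collapse (suc zero)    = u'
  collapse (suc (suc a)) = a

  reach-collapse : ∀ {a b} → Reach E⁺ a b → Reach E (collapse a) (collapse b)
  reach-collapse ε = ε
  reach-collapse (_◅_ {zero}          () _)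
  reach-collapse (_◅_ {suc zero}      () _)
  reach-collapse (_◅_ {suc (suc a)} {zero}        au p) rewrite ==⇒≡ au = reach-collapse p
  reach-collapse (_◅_ {suc (suc a)} {suc zero}    au p) rewrite ==⇒≡ au = reach-collapse p
  reach-collapse (_◅_ {suc (suc a)} {suc (suc b)} ab p) with arc-old a b ab
  ... | inj₁ (refl , refl) = tv ◅◅ reach-collapse p
  ... | inj₂ ab'           = ab' ◅ reach-collapse p

  acyclic⁺ : Acyclic E⁺
  acyclic⁺ zero          _             () _
  acyclic⁺ (suc zero)    _             () _
  acyclic⁺ (suc (suc a)) zero          _  (() ◅ _)
  acyclic⁺ (suc (suc a)) (suc zero)    _  (() ◅ _)
  acyclic⁺ (suc (suc a)) (suc (suc b)) ab p with arc-old a b ab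
  ... | inj₁ (refl , refl) = acyclic-antisym E ac t≢v tv (reach-collapse p)
  ... | inj₂ ab'           = ac a b ab' (reach-collapse p)

  module _ (rooted : ∀ w → Reach E (root G) w) where

    private
      ρ⁺ : Fin (suc (suc (size G)))
      ρ⁺ = root (addB G t v u u')

    -- Along a path in E, a vertex stays reachable in E⁺ until the path enters v.
    reach-or-below-v : ∀ {a c} → Reach E⁺ ρ⁺ (suc (suc a)) ⊎ Reach E v a → Reach E a c →
                       Reach E⁺ ρ⁺ (suc (suc c)) ⊎ Reach E v c
    reach-or-below-v reached ε = reached
    reach-or-below-v (inj₂ va) (ab ◅ p) = reach-or-below-v (inj₂ (va ◅◅ (ab ◅ ε))) p
    reach-or-below-v (inj₁ ρa) (ab ◅ p) with arc-new ab
    ... | inj₁ ab⁺  = reach-or-below-v (inj₁ (ρa ◅◅ (ab⁺ ◅ ε))) p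
    ... | inj₂ refl = reach-or-below-v (inj₂ ε) p

    reach-v : Reach E⁺ ρ⁺ (suc (suc v))
    reach-v with reach-or-below-v (inj₁ ε) (rooted t)
    ... | inj₁ ρt = ρt ◅◅ (tv⁺ ◅ ε)
      where
      tv⁺ : Arc E⁺ (suc (suc t)) (suc (suc v))
      tv⁺ rewrite ==-refl t | ==-refl v = refl
    ... | inj₂ vt = ⊥-elim (acyclic-antisym E ac t≢v tv vt)

    reach-lift : ∀ {a c} → Reach E⁺ ρ⁺ (suc (suc a)) → Reach E a c → Reach E⁺ ρ⁺ (suc (suc c))
    reach-lift ρa ε = ρa
    reach-lift ρa (ab ◅ p) with arc-new ab
    ... | inj₁ ab⁺  = reach-lift (ρa ◅◅ (ab⁺ ◅ ε)) p
    ... | inj₂ refl = reach-lift reach-v p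

    rooted⁺ : ∀ w → Reach E⁺ ρ⁺ w
    rooted⁺ zero          = reach-lift ε (rooted u) ◅◅ (==-refl u ◅ ε)
    rooted⁺ (suc zero)    = reach-lift ε (rooted u') ◅◅ (==-refl u' ◅ ε)
    rooted⁺ (suc (suc w)) = reach-lift ε (rooted w)

  indeg-new₀ : indeg E⁺ zero ≡ 1
  indeg-new₀ = trans (indeg-count E⁺ zero) (count-singleton u)

  indeg-new₁ : indeg E⁺ (suc zero) ≡ 1
  indeg-new₁ = trans (indeg-count E⁺ (suc zero)) (count-singleton u')

  indeg-old : ∀ b → b ≢ v → indeg E⁺ (suc (suc b)) ≡ indeg E b
  indeg-old b b≢v = trans (indeg-count E⁺ _) (trans (count-cong λ a → arc-not-into-v a b b≢v) (sym (indeg-count E b)))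

  indeg-v : indeg E⁺ (suc (suc v)) ≡ 1
  indeg-v = trans (indeg-count E⁺ _) (trans (count-cong only-from-top) (count-singleton t))
    where
    only-from-top : ∀ a → E⁺ (suc (suc a)) (suc (suc v)) ≡ (a == t)
    only-from-top a with eqView a t
    ... | equal refl a=t rewrite a=t | ==-refl v = refl
    ... | distinct _ a≠t rewrite a≠t | ==-refl v with (a == u) ∨ (a == u') in parent | E a v in av
    ...   | true  | _     = refl
    ...   | false | false = refl
    ...   | false | true with parent-of-v av
    ...     | inj₁ refl rewrite ==-refl u = ⊥-elim (false≢true (sym parent))
    ...     | inj₂ refl rewrite ==-refl u' | ∨-zeroʳ (u' == u) = ⊥-elim (false≢true (sym parent))

  indeg≤2⁺ : (∀ w → indeg E w ≤ 2) → ∀ w → indeg E⁺ w ≤ 2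
  indeg≤2⁺ _  zero          rewrite indeg-new₀ = s≤s z≤n
  indeg≤2⁺ _  (suc zero)    rewrite indeg-new₁ = s≤s z≤n
  indeg≤2⁺ ≤2 (suc (suc b)) with eqView b v
  ... | equal refl _   rewrite indeg-v       = s≤s z≤n
  ... | distinct b≢v _ rewrite indeg-old b b≢v = ≤2 b

  numReticulations-addB : numReticulations E ≡ suc (numReticulations E⁺)
  numReticulations-addB = begin
    numReticulations E                     ≡⟨ numReticulations-count E ⟩
    sumFin R                               ≡⟨ +-identityʳ _ ⟨
    sumFin R + 0                           ≡⟨ cong (λ d → sumFin R + bit (d ≡ᵇ 2)) indeg-v ⟨
    sumFin R + R⁺ v                        ≡⟨ sumFin-update R R⁺ v R≈R⁺ ⟩
    sumFin R⁺ + R v                        ≡⟨ cong (λ d → sumFin R⁺ + bit (d ≡ᵇ 2)) ret ⟩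
    sumFin R⁺ + 1                          ≡⟨ +-comm _ 1 ⟩
    suc (sumFin R⁺)                        ≡⟨ cong₂ (λ d₀ d₁ → suc (bit (d₀ ≡ᵇ 2) + (bit (d₁ ≡ᵇ 2) + sumFin R⁺)))
                                                       indeg-new₀ indeg-new₁ ⟨
    suc (count (λ w → indeg E⁺ w ≡ᵇ 2))    ≡⟨ cong suc (numReticulations-count E⁺) ⟨
    suc (numReticulations E⁺)              ∎
    where
    open ≡-Reasoning
    R R⁺ : Fin (size G) → ℕ
    R  w = bit (indeg E w ≡ᵇ 2)
    R⁺ w = bit (indeg E⁺ (suc (suc w)) ≡ᵇ 2)
    R≈R⁺ : ∀ w → w ≢ v → R w ≡ R⁺ w
    R≈R⁺ w w≢v = cong (λ d → bit (d ≡ᵇ 2)) (sym (indeg-old w w≢v))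

  isLeafB-old : ∀ a → isLeafB E⁺ (suc (suc a)) ≡ isLeafB E a
  isLeafB-old a = isLeafB-cong E E⁺ {a} {suc (suc a)} out-old out-new
    where
    out-old : ∀ b → Arc E a b → ∃ (Arc E⁺ (suc (suc a)))
    out-old b ab with eqView b v
    ... | distinct b≢v _ = suc (suc b) , trans (arc-not-into-v a b b≢v) ab
    ... | equal refl _ with parent-of-v ab
    ...   | inj₁ refl = zero , ==-refl u
    ...   | inj₂ refl = suc zero , ==-refl u'
    out-new : ∀ b → Arc E⁺ (suc (suc a)) b → ∃ (Arc E a)
    out-new zero          au rewrite ==⇒≡ au = v , uv
    out-new (suc zero)    au rewrite ==⇒≡ au = v , u'v
    out-new (suc (suc b)) ab with arc-old a b ab
    ... | inj₁ (refl , _) = top-has-child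
    ... | inj₂ ab'        = b , ab'

  numLeaves-addB : numLeaves E⁺ ≡ 2 + numLeaves E
  numLeaves-addB = trans (numLeaves-count E⁺) (cong₂ _+_ (cong bit new₀) (cong₂ _+_ (cong bit new₁)
    (trans (count-cong {f = λ a → isLeafB E⁺ (suc (suc a))} isLeafB-old) (sym (numLeaves-count E)))))
    where
    new₀ : isLeafB E⁺ zero ≡ true
    new₀ = isLeafB-true E⁺ {zero} λ _ → refl
    new₁ : isLeafB E⁺ (suc zero) ≡ true
    new₁ = isLeafB-true E⁺ {suc zero} λ _ → refl

module _ {m : ℕ} (E : Arcs m) {t v w w' : Fin m} where

  retCycle-left : RetCycle E t v w w' → Arc E t w
  retCycle-left (_ , is , _ , ch , _ , _ , refl , _) = chain-first E t is v ch

  retCycle-right : RetCycle E t v w w' → Arc E t w'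
  retCycle-right (_ , _ , is , _ , ch , _ , _ , refl , _) = chain-first E t is v ch

  retCycle-distinct : RetCycle E t v w w' → w ≢ w'
  retCycle-distinct (_ , _ , _ , _ , _ , _ , _ , _ , w≢w') = w≢w'

  retCycle-reach : RetCycle E t v w w' → Reach E t v
  retCycle-reach (_ , is , _ , ch , _) = chain-reach-end E t is v ch

  retCycle-top≢ : Acyclic E → RetCycle E t v w w' → t ≢ v
  retCycle-top≢ ac (_ , is , _ , ch , _) = chain-endpoints-≢ E ac t is v ch

record IsNetwork (G : LGraph) : Set where
  field
    acyclic : Acyclic (arcs G)
    rooted  : ∀ w → Reach (arcs G) (root G) w
    indeg≤2 : ∀ w → indeg (arcs G) w ≤ 2

weight : ∀ {m} → Arcs m → ℕ
weight E = numLeaves E + 2 * numReticulations E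

stepA-network : ∀ {G G'} → StepA G G' → IsNetwork G → IsNetwork G' × weight (arcs G') ≡ weight (arcs G)
stepA-network (stepA G t v w w' C _) N =
  record { acyclic = acyclic⁺ (IsNetwork.acyclic N) ; rooted = rooted⁺ (IsNetwork.rooted N)
         ; indeg≤2 = indeg≤2⁺ (IsNetwork.indeg≤2 N) } , cong₂ (λ l r → l + 2 * r) numLeaves-addA numReticulations-addA
  where open AddA G (retCycle-left (arcs G) C) (retCycle-right (arcs G) C) (retCycle-distinct (arcs G) C)

stepB-network : ∀ {G G'} → StepB G G' → IsNetwork G →
  IsNetwork G' × weight (arcs G') ≡ weight (arcs G) × numReticulations (arcs G) ≡ suc (numReticulations (arcs G'))
stepB-network (stepB G t v w w' u u' C _ uv u'v u≢u') N =
  record { acyclic = acyclic⁺ ; rooted = rooted⁺ (IsNetwork.rooted N) ; indeg≤2 = indeg≤2⁺ (IsNetwork.indeg≤2 N) } ,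
  weight-addB , numReticulations-addB
  where
  ac = IsNetwork.acyclic N
  open AddB G ac (proj₁ C) uv u'v u≢u' (retCycle-reach (arcs G) C) (retCycle-top≢ (arcs G) ac C)
  weight-addB : weight (arcs (addB G t v u u')) ≡ weight (arcs G)
  weight-addB rewrite numLeaves-addB | numReticulations-addB =
    trans (cong (_+ 2 * R) (+-comm 2 L)) (trans (+-assoc L 2 (2 * R)) (cong (L +_) (sym (*-suc 2 R))))
    where
    L = numLeaves (arcs G)
    R = numReticulations (arcs (addB G t v u u'))

steps-network : ∀ {Step : LGraph → LGraph → Set} →
  (∀ {G G'} → Step G G' → IsNetwork G → IsNetwork G' × weight (arcs G') ≡ weight (arcs G)) →
  ∀ {G G'} → Star Step G G' → IsNetwork G → IsNetwork G' × weight (arcs G') ≡ weight (arcs G)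
steps-network step ε        N = N , refl
steps-network step (s ◅ ss) N =
  let N' , w≡ = step s N ; N'' , w≡' = steps-network step ss N' in N'' , trans w≡' w≡

-- Degree of P(T, λ)

Positive : Poly → Set
Positive = All λ (c , _) → ∃ λ k → c ≡ ℤ.+ suc k

AttainsDegree : ℕ → Poly → Set
AttainsDegree d = Any λ (_ , mono) → totalDegree mono ≡ d

DegreeAtMost : ℕ → Poly → Set
DegreeAtMost d = All λ (_ , mono) → totalDegree mono ≤ d

TopDegree : Poly → ℕ → Set
TopDegree p d = AttainsDegree d p × DegreeAtMost d p

coeff-nonneg : ∀ p mono → Positive p → ∃ λ k → coeff p mono ≡ ℤ.+ k
coeff-nonneg []                  mono []              = 0 , refl
coeff-nonneg ((c , mono') ∷ p)   mono ((k , refl) ∷ pos) with VecP.≡-dec Data.Nat._≟_ mono' mono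
... | yes _ = let j , eq = coeff-nonneg p mono pos in suc k + j , cong (ℤ._+_ (ℤ.+ suc k)) eq
... | no  _ = coeff-nonneg p mono pos

coeff-pos : ∀ p {c} mono → Positive p → (c , mono) ∈ p → ∃ λ k → coeff p mono ≡ ℤ.+ suc k
coeff-pos ((c , mono') ∷ p) mono ((k , refl) ∷ pos) mono∈ with VecP.≡-dec Data.Nat._≟_ mono' mono | mono∈
... | yes _      | _            = let j , eq = coeff-nonneg p mono pos in k + j , cong (ℤ._+_ (ℤ.+ suc k)) eq
... | no  mono'≢ | here refl    = ⊥-elim (mono'≢ refl)
... | no  _      | there mono∈' = coeff-pos p mono pos mono∈'

coeff≢0-occurs : ∀ p mono → coeff p mono ≢ ℤ.+ 0 → ∃ λ c → (c , mono) ∈ p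
coeff≢0-occurs []                mono c≢0 = ⊥-elim (c≢0 refl)
coeff≢0-occurs ((c , mono') ∷ p) mono c≢0 with VecP.≡-dec Data.Nat._≟_ mono' mono
... | yes refl = c , here refl
... | no  _    = let c' , mono∈ = coeff≢0-occurs p mono c≢0 in c' , there mono∈

hasDegree : ∀ p d → Positive p → TopDegree p d → HasDegree p d
hasDegree p d pos (top , ≤d) with find top
... | (c , mono) , mono∈ , deg =
  (mono , deg , λ c≡0 → let k , c≡ = coeff-pos p mono pos mono∈ in suc≢0 (trans (sym c≡) c≡0)) ,
  λ mono' c≢0 → let c' , mono'∈ = coeff≢0-occurs p mono' c≢0 in All.lookup ≤d mono'∈
  where
  suc≢0 : ∀ {k} → ℤ.+ suc k ≢ ℤ.+ 0
  suc≢0 ()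

sum-zipWith-+ : ∀ {n} (a b : Vec ℕ n) → Vec.sum (zipWith _+_ a b) ≡ Vec.sum a + Vec.sum b
sum-zipWith-+ []       []       = refl
sum-zipWith-+ (a ∷ as) (b ∷ bs) = trans (cong (a + b +_) (sum-zipWith-+ as bs)) (+-interchange a b _ _)

⊗-positive : ∀ p p' → Positive p → Positive p' → Positive (p ⊗ p')
⊗-positive []            p' _                 _    = []
⊗-positive ((c , _) ∷ p) p' ((k , refl) ∷ pos) pos' =
  AllP.++⁺ (AllP.map⁺ (All.map (λ { (k' , refl) → _ , refl }) pos')) (⊗-positive p p' pos pos')

⊗-topDegree : ∀ p p' {d d'} → TopDegree p d → TopDegree p' d' → TopDegree (p ⊗ p') (d + d')
⊗-topDegree p p' {d} {d'} (top , ≤d) (top' , ≤d') = ⊗-attains p top , ⊗-atMost p ≤d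
  where
  ⊗-attains : ∀ p → AttainsDegree d p → AttainsDegree (d + d') (p ⊗ p')
  ⊗-attains ((c , mono) ∷ p) (here deg) =
    AnyP.++⁺ˡ (AnyP.map⁺ (Any.map (λ deg' → trans (sum-zipWith-+ mono _) (cong₂ _+_ deg deg')) top'))
  ⊗-attains (_ ∷ p)          (there t)  = AnyP.++⁺ʳ _ (⊗-attains p t)
  ⊗-atMost : ∀ p → DegreeAtMost d p → DegreeAtMost (d + d') (p ⊗ p')
  ⊗-atMost []               []         = []
  ⊗-atMost ((c , mono) ∷ p) (≤d ∷ ≤ds) = AllP.++⁺
    (AllP.map⁺ (All.map (λ ≤d' → subst (_≤ d + d') (sym (sum-zipWith-+ mono _)) (+-mono-≤ ≤d ≤d')) ≤d'))
    (⊗-atMost p ≤ds)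

var-degree : ∀ l → Positive (var l) × TopDegree (var l) 1
var-degree Label.x = (_ , refl) ∷ [] , here refl , ≤-refl ∷ []
var-degree Label.y = (_ , refl) ∷ [] , here refl , ≤-refl ∷ []
var-degree Label.z = (_ , refl) ∷ [] , here refl , ≤-refl ∷ []
var-degree Label.q = (_ , refl) ∷ [] , here refl , ≤-refl ∷ []
var-degree Label.r = (_ , refl) ∷ [] , here refl , ≤-refl ∷ []
var-degree Label.s = (_ , refl) ∷ [] , here refl , ≤-refl ∷ []

var⊕-degree : ∀ l p {d} → 1 ≤ d → Positive p → TopDegree p d → Positive (var l ⊕ p) × TopDegree (var l ⊕ p) d
var⊕-degree l p 1≤d pos (top , ≤d) = AllP.++⁺ (proj₁ (var-degree l)) pos ,
  AnyP.++⁺ʳ (var l) top , AllP.++⁺ (All.map (λ ≤1 → ≤-trans ≤1 1≤d) (proj₂ (proj₂ (var-degree l)))) ≤d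

prodP-degree : ∀ {A : Set} (P : A → Poly) (d : A → ℕ) → (∀ a → Positive (P a) × TopDegree (P a) (d a)) →
  ∀ as → Positive (prodP (map P as)) × TopDegree (prodP (map P as)) (sum (map d as))
prodP-degree P d deg []       = (_ , refl) ∷ [] , here refl , z≤n ∷ []
prodP-degree P d deg (a ∷ as) =
  let pos , top = deg a ; pos' , top' = prodP-degree P d deg as
  in ⊗-positive (P a) _ pos pos' , ⊗-topDegree (P a) _ top top'

-- The recursion defining Pat, counting 1 for each leaf.
leafCount : (G : LGraph) → ℕ → Fin (size G) → ℕ
leafCount G zero    v = 1
leafCount G (suc f) v with children (arcs G) v
... | []          = 1
... | cs@(_ ∷ _) = sum (map (leafCount G f) cs)

Pat-degree : ∀ G f v → Positive (Pat G f v) × TopDegree (Pat G f v) (leafCount G f v) × 1 ≤ leafCount G f v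
Pat-degree G zero    v = proj₁ (var-degree _) , proj₂ (var-degree _) , ≤-refl
Pat-degree G (suc f) v with children (arcs G) v
... | []           = proj₁ (var-degree _) , proj₂ (var-degree _) , ≤-refl
... | cs@(c ∷ _) =
  let pos , top   = prodP-degree (Pat G f) (leafCount G f) (λ c → let pos , top , _ = Pat-degree G f c in pos , top) cs
      1≤          = ≤-trans (proj₂ (proj₂ (Pat-degree G f c))) (m≤m+n (leafCount G f c) _)
      pos' , top' = var⊕-degree _ _ 1≤ pos top
  in pos' , top' , 1≤

Qof-degree : ∀ G → HasDegree (Qof G) (leafCount G (size G) (root G))
Qof-degree G = let pos , top , _ = Pat-degree G (size G) (root G) in hasDegree _ _ pos top

-- Leaves of a rooted tree

does-true : ∀ {A : Set} (d : Dec A) → does d ≡ true → A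
does-true (yes a) _ = a

sum-count-disjoint : ∀ {n} (g : Fin n → Fin n → Bool) cs → Unique cs →
  (∀ {c c'} → c ∈ cs → c' ∈ cs → c ≢ c' → ∀ ℓ → g c ℓ ≡ true → g c' ℓ ≡ true → ⊥) →
  sum (map (count ∘ g) cs) ≡ count (λ ℓ → any (λ c → g c ℓ) cs)
sum-count-disjoint {n} g [] _ _ = sym (count-allFalse {n} _ λ _ → refl)
sum-count-disjoint g (c ∷ cs) (c∉ ∷ uniq) disjoint =
  trans (cong (count (g c) +_) (sum-count-disjoint g cs uniq λ c∈ c'∈ → disjoint (there c∈) (there c'∈)))
        (sym (count-∨ (g c) _ λ ℓ gcℓ any≡ → let c' , c'∈ , gc'ℓ = any-true⁻ _ cs any≡ in
                                           disjoint (here refl) (there c'∈) (All.lookup c∉ c'∈) ℓ gcℓ gc'ℓ))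

module Tree (G : LGraph) (ac : Acyclic (arcs G)) (indeg≤1 : ∀ w → indeg (arcs G) w ≤ 1) where

  private
    n : ℕ
    n = size G
    E : Arcs n
    E = arcs G

  unique-parent : ∀ {a b w} → Arc E a w → Arc E b w → a ≡ b
  unique-parent {a} {b} {w} aw bw with eqView a b
  ... | equal a≡b _    = a≡b
  ... | distinct a≢b _ = ⊥-elim (1+n≰n (≤-trans two-parents (indeg≤1 w)))
    where
    two-parents : 2 ≤ indeg E w
    two-parents rewrite indeg-count E w = count-≥2 (λ a → E a w) a≢b aw bw

  -- Paths are traversed backwards so that their last arcs can be matched.
  comparable : ∀ {a b ℓ} → Star (flip (Arc E)) ℓ a → Star (flip (Arc E)) ℓ b → Reach E a b ⊎ Reach E b a
  comparable ε        q         = inj₂ (Star-reverse id q)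
  comparable (e ◅ p)  ε         = inj₁ (Star-reverse id (e ◅ p))
  comparable (e ◅ p)  (e' ◅ q) with unique-parent e e'
  ... | refl = comparable p q

  sibling-unreachable : ∀ {v c c'} → Arc E v c → Arc E v c' → c ≢ c' → Star (flip (Arc E)) c' c → ⊥
  sibling-unreachable _  _   c≢c' ε          = c≢c' refl
  sibling-unreachable vc vc' _    (xc' ◅ p) with unique-parent xc' vc'
  ... | refl = ac _ _ vc (Star-reverse id p)

  siblings-disjoint : ∀ {v c c' ℓ} → Arc E v c → Arc E v c' → c ≢ c' → Reach E c ℓ → Reach E c' ℓ → ⊥
  siblings-disjoint vc vc' c≢c' p p' with comparable (Star-reverse id p) (Star-reverse id p')
  ... | inj₁ cc' = sibling-unreachable vc vc' c≢c' (Star-reverse id cc')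
  ... | inj₂ c'c = sibling-unreachable vc' vc (c≢c' ∘ sym) (Star-reverse id c'c)

  leafBelow : Fin n → Fin n → Bool
  leafBelow v ℓ = isLeafB E ℓ ∧ does (reach? E ac v ℓ)

  leafBelow-reach : ∀ {v ℓ} → leafBelow v ℓ ≡ true → Reach E v ℓ
  leafBelow-reach {v} {ℓ} below = does-true (reach? E ac v ℓ) (proj₂ (∧-true below))

  leafBelow-leaf : ∀ {v} → (∀ c → E v c ≡ false) → count (leafBelow v) ≡ 1
  leafBelow-leaf {v} no-arc = trans (count-cong only-v) (count-singleton v)
    where
    only-v : ∀ ℓ → leafBelow v ℓ ≡ (ℓ == v)
    only-v ℓ with eqView ℓ v
    ... | equal refl v=v rewrite isLeafB-true E no-arc | dec-true (reach? E ac v v) ε = sym v=v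
    ... | distinct ℓ≢v ℓ≠v rewrite ℓ≠v = trans (cong (isLeafB E ℓ ∧_) (dec-false (reach? E ac v ℓ) unreachable))
                                               (∧-zeroʳ _)
      where
      unreachable : ¬ Reach E v ℓ
      unreachable ε        = ℓ≢v refl
      unreachable (vc ◅ _) = false≢true (trans (sym (no-arc _)) vc)

  children-arc : ∀ {v c} → c ∈ children E v → Arc E v c
  children-arc {v} c∈ = proj₂ (∈-filter⁻ (λ w → E v w Data.Bool.≟ true) {xs = allFin n} c∈)

  arc-children : ∀ {v c} → Arc E v c → c ∈ children E v
  arc-children {v} {c} vc = ∈-filter⁺ (λ w → E v w Data.Bool.≟ true) (∈-allFin c) vc

  children-unique : ∀ v → Unique (children E v)
  children-unique v = UniqueP.filter⁺ (λ w → E v w Data.Bool.≟ true) (UniqueP.allFin⁺ n)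

  leafBelow-children : ∀ {v c₀} cs → children E v ≡ c₀ ∷ cs →
                       ∀ ℓ → any (λ c → leafBelow c ℓ) (c₀ ∷ cs) ≡ leafBelow v ℓ
  leafBelow-children {v} {c₀} cs eq ℓ = bool-ext via-child from-v
    where
    child : ∀ {c} → c ∈ c₀ ∷ cs → Arc E v c
    child c∈ = children-arc (subst (_ ∈_) (sym eq) c∈)
    via-child : any (λ c → leafBelow c ℓ) (c₀ ∷ cs) ≡ true → leafBelow v ℓ ≡ true
    via-child any≡ with any-true⁻ _ (c₀ ∷ cs) any≡
    ... | c , c∈ , below = ∧-intro (proj₁ (∧-true below)) (dec-true (reach? E ac v ℓ) (child c∈ ◅ leafBelow-reach below))
    from-v : leafBelow v ℓ ≡ true → any (λ c → leafBelow c ℓ) (c₀ ∷ cs) ≡ true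
    from-v below with proj₁ (∧-true below) | leafBelow-reach below
    ... | leaf | ε       = ⊥-elim (false≢true (trans (sym (isLeafB-noArc E leaf c₀)) (child (here refl))))
    ... | leaf | vc ◅ cℓ = any-true⁺ _ (subst (_ ∈_) eq (arc-children vc)) (∧-intro leaf (dec-true (reach? E ac _ ℓ) cℓ))

  leafCount-leafBelow : ∀ f v → (∀ {w} (p : Reach E v w) → pathLength E p ≤ f) →
                        leafCount G f v ≡ count (leafBelow v)
  leafCount-leafBelow zero v shallow = sym (leafBelow-leaf no-arc)
    where
    no-arc : ∀ c → E v c ≡ false
    no-arc c with E v c in vc
    ... | false = refl
    ... | true  with shallow (vc ◅ ε)
    ... | ()
  leafCount-leafBelow (suc f) v shallow with children (arcs G) v in eq
  ... | [] = sym (leafBelow-leaf no-arc)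
    where
    no-arc : ∀ c → E v c ≡ false
    no-arc c with E v c in vc
    ... | false = refl
    ... | true with subst (c ∈_) eq (arc-children vc)
    ... | ()
  ... | c₀ ∷ cs = begin
    sum (map (leafCount G f) (c₀ ∷ cs))               ≡⟨ cong sum (map-cong-local (All.tabulate below-child)) ⟩
    sum (map (count ∘ leafBelow) (c₀ ∷ cs))           ≡⟨ sum-count-disjoint leafBelow (c₀ ∷ cs) unique disjoint ⟩
    count (λ ℓ → any (λ c → leafBelow c ℓ) (c₀ ∷ cs)) ≡⟨ count-cong (leafBelow-children cs eq) ⟩
    count (leafBelow v)                               ∎
    where
    open ≡-Reasoning
    child : ∀ {c} → c ∈ c₀ ∷ cs → Arc E v c
    child c∈ = children-arc (subst (_ ∈_) (sym eq) c∈)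
    below-child : ∀ {c} → c ∈ c₀ ∷ cs → leafCount G f c ≡ count (leafBelow c)
    below-child c∈ = leafCount-leafBelow f _ λ p → s≤s⁻¹ (shallow (child c∈ ◅ p))
    unique : Unique (c₀ ∷ cs)
    unique = subst Unique eq (children-unique v)
    disjoint : ∀ {c c'} → c ∈ c₀ ∷ cs → c' ∈ c₀ ∷ cs → c ≢ c' → ∀ ℓ → leafBelow c ℓ ≡ true → leafBelow c' ℓ ≡ true → ⊥
    disjoint c∈ c'∈ c≢c' ℓ below below' =
      siblings-disjoint (child c∈) (child c'∈) c≢c' (leafBelow-reach below) (leafBelow-reach below')

  leafCount-root : (∀ w → Reach E (root G) w) → leafCount G (size G) (root G) ≡ numLeaves E
  leafCount-root rooted = begin
    leafCount G n (root G)       ≡⟨ leafCount-leafBelow n (root G) (λ p → <⇒≤ (pathLength< E ac p)) ⟩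
    count (leafBelow (root G))   ≡⟨ count-cong every-leaf-below ⟩
    count (isLeafB E)            ≡⟨ numLeaves-count E ⟨
    numLeaves E                  ∎
    where
    open ≡-Reasoning
    every-leaf-below : ∀ ℓ → leafBelow (root G) ℓ ≡ isLeafB E ℓ
    every-leaf-below ℓ rewrite dec-true (reach? E ac (root G) ℓ) (rooted ℓ) = ∧-identityʳ _

weight-noReticulation : ∀ {m} (E : Arcs m) → (∀ w → ¬ IsReticulation E w) → weight E ≡ numLeaves E
weight-noReticulation E none = trans (cong (λ k → numLeaves E + 2 * k) (trans (numReticulations-count E)
  (count-allFalse _ not-two))) (+-identityʳ _)
  where
  not-two : ∀ w → (indeg E w ≡ᵇ 2) ≡ false
  not-two w with indeg E w ≡ᵇ 2 in eq
  ... | false = refl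
  ... | true  = ⊥-elim (none w (≡ᵇ⇒≡ (indeg E w) 2 (subst Data.Bool.T (sym eq) _)))

≤2∧≢2⇒≤1 : ∀ {a} → a ≤ 2 → a ≢ 2 → a ≤ 1
≤2∧≢2⇒≤1 {0} _ _ = z≤n
≤2∧≢2⇒≤1 {1} _ _ = s≤s z≤n
≤2∧≢2⇒≤1 {2} _ ≢2 = ⊥-elim (≢2 refl)
≤2∧≢2⇒≤1 {suc (suc (suc _))} (s≤s (s≤s ())) _

expansion-degree : ∀ m (E : Arcs m) ρ → IsNetwork (mkLG m E (λ _ → nothing) ρ) →
  ∀ G → Expansion m E ρ G → HasDegree (Qof G) (weight E)
expansion-degree m E ρ N G (G₁ , stepsA , _ , stepsB , no-ret) =
  subst (HasDegree (Qof G)) leafCount≡weight (Qof-degree G)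
  where
  afterA : IsNetwork G₁ × weight (arcs G₁) ≡ weight E
  afterA = steps-network stepA-network stepsA N
  afterB : IsNetwork G × weight (arcs G) ≡ weight (arcs G₁)
  afterB = steps-network (λ s N → let N' , w≡ , _ = stepB-network s N in N' , w≡) stepsB (proj₁ afterA)
  open IsNetwork (proj₁ afterB)
  open Tree G acyclic (λ w → ≤2∧≢2⇒≤1 (indeg≤2 w) (no-ret w))
  leafCount≡weight : leafCount G (size G) (root G) ≡ weight E
  leafCount≡weight = begin
    leafCount G (size G) (root G) ≡⟨ leafCount-root rooted ⟩
    numLeaves (arcs G)            ≡⟨ weight-noReticulation (arcs G) no-ret ⟨
    weight (arcs G)               ≡⟨ trans (proj₂ afterB) (proj₂ afterA) ⟩
    weight E                      ∎
    where open ≡-Reasoning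

-- Existence of the expansion

listsUpTo : ∀ m → ℕ → List (List (Fin m))
listsUpTo m zero    = [ [] ]
listsUpTo m (suc k) = [] ∷ cartesianProductWith _∷_ (allFin m) (listsUpTo m k)

∈-listsUpTo : ∀ {m} k xs → length xs ≤ k → xs ∈ listsUpTo m k
∈-listsUpTo zero    []       _        = here refl
∈-listsUpTo (suc k) []       _        = here refl
∈-listsUpTo (suc k) (a ∷ xs) (s≤s ≤k) = there (∈-cartesianProductWith⁺ _∷_ (∈-allFin a) (∈-listsUpTo k xs ≤k))

PendingA : LGraph → Set
PendingA G = Σ (Fin (size G)) λ t → Σ (Fin (size G)) λ v → Σ (Fin (size G)) λ w → Σ (Fin (size G)) λ w' →
  RetCycle (arcs G) t v w w' × label G t ≢ just Label.s

module _ (G : LGraph) (ac : Acyclic (arcs G)) where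

  private
    m : ℕ
    m = size G
    E : Arcs m
    E = arcs G

  open DecMembership (Fin._≟_ {m}) using (_∈?_)

  chain? : ∀ xs → Dec (Chain E xs)
  chain? []           = yes _
  chain? (a ∷ [])     = yes _
  chain? (a ∷ b ∷ xs) = (E a b Data.Bool.≟ true) ×-dec chain? (b ∷ xs)

  disjoint? : ∀ xs ys → Dec (Disjoint E xs ys)
  disjoint? xs ys with all? (λ x → ¬? (x ∈? ys)) xs
  ... | yes xs∉ys = yes λ w w∈xs w∈ys → All.lookup xs∉ys w∈xs w∈ys
  ... | no ¬xs∉ys = no λ dj → ¬xs∉ys (All.tabulate (dj _))

  Pending : Fin m → Fin m → List (Fin m) → List (Fin m) → Set
  Pending t v is₁ is₂ = IsReticulation E v × Chain E (t ∷ is₁ ++ [ v ]) × Chain E (t ∷ is₂ ++ [ v ]) ×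
    Disjoint E is₁ is₂ × secondOf E is₁ v ≢ secondOf E is₂ v × label G t ≢ just Label.s

  pending? : ∀ t v is₁ is₂ → Dec (Pending t v is₁ is₂)
  pending? t v is₁ is₂ = (indeg E v Data.Nat.≟ 2) ×-dec chain? _ ×-dec chain? _ ×-dec disjoint? is₁ is₂ ×-dec
    ¬? (secondOf E is₁ v Fin.≟ secondOf E is₂ v) ×-dec ¬? (labelledS? (label G t))

  internal-length : ∀ t is v → Chain E (t ∷ is ++ [ v ]) → length is ≤ m
  internal-length t is v ch = begin
    length is            ≤⟨ m≤m+n (length is) 1 ⟩
    length is + 1        ≡⟨ length-++ is ⟨
    length (is ++ [ v ]) <⟨ unique-length (chain-unique E ac (is ++ [ v ]) ch) ⟩
    m                    ∎
    where open ≤-Reasoning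

  pendingA? : PendingA G ⊎ PhaseADone G
  pendingA? with FinP.any? (λ t → FinP.any? λ v →
                   any? (λ is₁ → any? (λ is₂ → pending? t v is₁ is₂) (listsUpTo m m)) (listsUpTo m m))
  ... | yes (t , v , found) with satisfied found
  ... | is₁ , found' with satisfied found'
  ... | is₂ , (ret , ch₁ , ch₂ , dj , second≢ , t≢s) =
    inj₁ (t , v , _ , _ , (ret , is₁ , is₂ , ch₁ , ch₂ , dj , refl , refl , second≢) , t≢s)
  pendingA? | no none = inj₂ done
    where
    done : PhaseADone G
    done t v w w' (ret , is₁ , is₂ , ch₁ , ch₂ , dj , refl , refl , second≢) with labelledS? (label G t)
    ... | yes t≡s = t≡s
    ... | no  t≢s = ⊥-elim (none (t , v ,
      Any.map (λ { refl → Any.map (λ { refl → ret , ch₁ , ch₂ , dj , second≢ , t≢s })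
                                  (∈-listsUpTo m is₂ (internal-length t is₂ v ch₂)) })
              (∈-listsUpTo m is₁ (internal-length t is₁ v ch₁))))

phaseA : ∀ k G → unlabelledOutdeg G < k → IsNetwork G →
  Σ LGraph λ G₁ → Star StepA G G₁ × PhaseADone G₁ × IsNetwork G₁
phaseA (suc k) G <k N with pendingA? G (IsNetwork.acyclic N)
... | inj₂ done = G , ε , done , N
... | inj₁ (t , v , w , w' , C , t≢s) =
  let G₁ , steps , done , N₁ = phaseA k (addA G t w w') decreased (proj₁ (stepA-network step N))
  in G₁ , step ◅ steps , done , N₁
  where
  step : StepA G (addA G t w w')
  step = stepA G t v w w' C t≢s
  open AddA G (retCycle-left (arcs G) C) (retCycle-right (arcs G) C) (retCycle-distinct (arcs G) C)
  decreased : unlabelledOutdeg (addA G t w w') < k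
  decreased = s≤s⁻¹ (subst (_< suc k) (unlabelledOutdeg-addA t≢s) <k)

module _ (G : LGraph) (ac : Acyclic (arcs G)) where

  private
    E : Arcs (size G)
    E = arcs G

  descendants : Fin (size G) → ℕ
  descendants v = count (λ w → does (reach? E ac v w))

  lowestBelow : ∀ k v → descendants v < k → IsReticulation E v →
                Σ (Fin (size G)) λ v' → IsReticulation E v' × Lowest G v'
  lowestBelow (suc k) v <k ret
    with FinP.any? (λ w → ¬? (w Fin.≟ v) ×-dec reach? E ac v w ×-dec indeg E w Data.Nat.≟ 2)
  ... | no none = v , ret , λ w w≢v vw ret-w → none (w , w≢v , vw , ret-w)
  ... | yes (w , w≢v , vw , ret-w) = lowestBelow k w (≤-trans fewer (s≤s⁻¹ <k)) ret-w
    where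
    fewer : descendants w < descendants v
    fewer = count-mono-< _ _ v (λ x wx → dec-true (reach? E ac v x) (vw ◅◅ does-true (reach? E ac w x) wx))
      (dec-true (reach? E ac v v) ε) (dec-false (reach? E ac w v) (acyclic-antisym E ac (w≢v ∘ sym) vw))

phaseB : ∀ k G → numReticulations (arcs G) < k → IsNetwork G →
  Σ LGraph λ G₂ → Star StepB G G₂ × NoReticulation G₂
phaseB (suc k) G <k N with FinP.any? (λ v → indeg (arcs G) v Data.Nat.≟ 2)
... | no none = G , ε , λ v ret → none (v , ret)
... | yes (v₀ , ret₀) with lowestBelow G (IsNetwork.acyclic N) _ v₀ ≤-refl ret₀
... | v , ret , lowest with reticulation-parents (arcs G) ret
... | u , u' , u≢u' , uv , u'v =
  let G₂ , steps , no-ret = phaseB k G' (s≤s⁻¹ (subst (_< suc k) fewer <k)) N' in G₂ , step ◅ steps , no-ret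
  where
  open IsNetwork N
  T : TopVertex (arcs G) u u'
  T = topVertex (arcs G) (rooted u) (rooted u')
  G' : LGraph
  G' = addB G (TopVertex.top T) v u u'
  step : StepB G G'
  step = stepB G (TopVertex.top T) v _ _ u u' (reticulationCycle (arcs G) acyclic ret uv u'v u≢u' T) lowest uv u'v u≢u'
  N' : IsNetwork G'
  N' = proj₁ (stepB-network step N)
  fewer : numReticulations (arcs G) ≡ suc (numReticulations (arcs G'))
  fewer = proj₂ (proj₂ (stepB-network step N))

expansion-exists : ∀ m (E : Arcs m) ρ → IsNetwork (mkLG m E (λ _ → nothing) ρ) → Σ LGraph (Expansion m E ρ)
expansion-exists m E ρ N =
  let G₁ , stepsA , done , N₁ = phaseA _ _ ≤-refl N
      G₂ , stepsB , no-ret    = phaseB _ G₁ ≤-refl N₁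
  in G₂ , G₁ , stepsA , done , stepsB , no-ret

theorem4 : (m : ℕ) (E : Arcs m) (ρ : Fin m) → IsRootedCactus E ρ →
    (Σ LGraph (Expansion m E ρ)) ×
    (∀ G → Expansion m E ρ G → HasDegree (Qof G) (numLeaves E + 2 * numReticulations E))
theorem4 m E ρ cactus@(acyclic , _ , _ , rooted , _) = expansion-exists m E ρ N , expansion-degree m E ρ N
  where
  N : IsNetwork (mkLG m E (λ _ → nothing) ρ)
  N = record { acyclic = acyclic ; rooted = rooted ; indeg≤2 = cactus-indeg≤2 E ρ cactus }
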